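{- Let $T$ be a tree on $k+1$ vertices, let $V_1,V_2$ be its two colour classes (in either order), let $\Delta=\max_{v\in V_2}\deg_T(v)$, and let $\ell\in\mathbb{N}$ with $\ell<k$. Then $T$ has a one-sided $\ell$-fine partition (with respect to $V_1,V_2$).
   Context: Let $T$ be a tree on $k+1$ vertices with colour classes $V_1,V_2$ and $\Delta=\max_{v\in V_2}\deg_T(v)$. A one-sided $\ell$-fine partition of $T$ is a pair $(W,\mathcal D)$ where $W\subseteq V_1$ and $\mathcal D$ is a family of subtrees of $T$ such that: (1) the sets $W$ and $V(K)$, $K\in\mathcal D$, partition $V(T)$; (2) $|W|\le 336k(1+\Delta)/\ell$; (3) $|V(K)|\le \ell$ for every $K\in\mathcal D$; (4) for every $K\in\mathcal D$, $N_T(V(K))\setminus V(K)\subseteq W$; (5) $\mathcal D$ can be split as a disjoint union $\mathcal D=\mathcal D'\sqcup\mathcal D''$ such that every tree in $\mathcal D'$ has at most two neighbours in $W$, and if it has two neighbours $z_1,z_2\in W$ then $\mathrm{dist}_T(z_1,z_2)\ge 4$; while $|\mathcal D''|\le 336k/\ell$ and every tree in $\mathcal D''$ is a single vertex with at most $\Delta$ neighbours in $W$. Here $N_T(S)$ is the set of vertices adjacent to some vertex of $S$ and $\mathrm{dist}_T$ is the path distance in $T$. -}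

module Defs where

open import Data.Nat using (ℕ; zero; suc; _+_; _*_; _≤_; _⊔_)
open import Data.Bool using (Bool; true; false; _∧_; if_then_else_)
open import Data.Fin using (Fin)
open import Data.Fin.Subset using (Subset; _∈_; _∩_; ∣_∣)
open import Data.Vec using (lookup; tabulate)
open import Data.List using (List; []; _∷_; _++_; length; map; foldr; allFin)
open import Data.Bool.ListAction using (any)
open import Data.Nat.ListAction using (sum)
open import Data.List.Relation.Unary.Unique.Propositional using (Unique)
open import Data.List.Relation.Unary.Linked using (Linked)
open import Data.Product using (Σ; ∃; _×_; _,_)
open import Relation.Binary.PropositionalEquality using (_≡_; _≢_)
open import Relation.Nullary using (¬_)
import Data.List.Membership.Propositional

record Graph (n : ℕ) : Set where
  field
    adj    : Fin n → Fin n → Bool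
    sym    : ∀ u v → adj u v ≡ adj v u
    irrefl : ∀ u → adj u u ≡ false

module _ {n : ℕ} (G : Graph n) where
  open Graph G

  E : Fin n → Fin n → Set
  E u v = adj u v ≡ true

  data Walk (R : Fin n → Fin n → Set) : Fin n → Fin n → ℕ → Set where
    here : ∀ {u} → Walk R u u 0
    step : ∀ {u v w m} → R u v → Walk R v w m → Walk R u w (suc m)

  Connected : Set
  Connected = ∀ u v → ∃ λ m → Walk E u v m

  HasCycle : Set
  HasCycle = Σ (Fin n) λ v → Σ (List (Fin n)) λ rest →
    Unique (v ∷ rest) × 2 ≤ length rest × Linked E (v ∷ rest ++ v ∷ [])

  IsTree : Set
  IsTree = Connected × ¬ HasCycle

  DistAtLeast : ℕ → Fin n → Fin n → Set
  DistAtLeast d u v = ∀ m → Walk E u v m → d ≤ m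

  -- proper 2-colouring; colour class V₁ = χ⁻¹(false), V₂ = χ⁻¹(true)
  ProperColouring : (Fin n → Bool) → Set
  ProperColouring χ = ∀ u v → E u v → χ u ≢ χ v

  deg : Fin n → ℕ
  deg v = ∣ tabulate (adj v) ∣

  -- Δ = max degree over V₂ = χ⁻¹(true) (0 if V₂ is empty)
  maxDegTrue : (Fin n → Bool) → ℕ
  maxDegTrue χ = foldr _⊔_ 0 (map (λ v → if χ v then deg v else 0) (allFin n))

  Nbhd : Subset n → Subset n
  Nbhd S = tabulate (λ w → any (λ u → lookup S u ∧ adj u w) (allFin n))

  -- S is the vertex set of a subtree of G: nonempty and G[S] connected
  -- (for G a tree, the induced subgraph is then a tree)
  IsSubtree : Subset n → Set
  IsSubtree S = (∃ λ v → v ∈ S) ×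
    (∀ u v → u ∈ S → v ∈ S → ∃ λ m → Walk (λ x y → E x y × x ∈ S × y ∈ S) u v m)

  occ : Fin n → List (Subset n) → ℕ
  occ v Ks = sum (map (λ K → if lookup K v then 1 else 0) Ks)

  -- One-sided ℓ-fine partition (W, 𝒟 = D₁ ⊔ D₂) of G w.r.t. colouring χ, k = n - 1.
  record OneSidedFine (k : ℕ) (χ : Fin n → Bool) (ℓ : ℕ)
                      (W : Subset n) (D₁ D₂ : List (Subset n)) : Set where
    field
      subtrees  : ∀ K → K Data.List.Membership.Propositional.∈ (D₁ ++ D₂) → IsSubtree K
      W⊆V₁      : ∀ v → v ∈ W → χ v ≡ false
      partition : ∀ v → (if lookup W v then 1 else 0) + occ v (D₁ ++ D₂) ≡ 1
      sizeW     : ∣ W ∣ * ℓ ≤ 336 * k * (1 + maxDegTrue χ)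
      smallK    : ∀ K → K Data.List.Membership.Propositional.∈ (D₁ ++ D₂) → ∣ K ∣ ≤ ℓ
      boundary  : ∀ K → K Data.List.Membership.Propositional.∈ (D₁ ++ D₂) →
                  ∀ u v → u ∈ K → E u v → ¬ (v ∈ K) → v ∈ W
      D₁-few    : ∀ K → K Data.List.Membership.Propositional.∈ D₁ → ∣ W ∩ Nbhd K ∣ ≤ 2
      D₁-far    : ∀ K → K Data.List.Membership.Propositional.∈ D₁ →
                  ∀ z₁ z₂ → z₁ ∈ W ∩ Nbhd K → z₂ ∈ W ∩ Nbhd K → z₁ ≢ z₂ →
                  DistAtLeast 4 z₁ z₂
      D₂-count  : length D₂ * ℓ ≤ 336 * k
      D₂-single : ∀ K → K Data.List.Membership.Propositional.∈ D₂ → ∣ K ∣ ≡ 1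
      D₂-nbrs   : ∀ K → K Data.List.Membership.Propositional.∈ D₂ →
                  ∣ W ∩ Nbhd K ∣ ≤ maxDegTrue χ

-- Root T and mark vertices greedily from the leaves: a vertex is marked as soon as the unmarked
-- region hanging below it reaches ℓ vertices or sees two marked vertices below it. A potential
-- argument bounds the marked set Q by 2(k+1)/ℓ. W is Q ∩ V₁ together with the neighbours of Q ∩ V₂,
-- repaired at "bad" vertices; each vertex of W lies near Q, so |W| ≤ |Q|(1+3Δ). The components of
-- T − W − P lie inside unmarked regions, hence are small and see only their parent and at most one
-- further W-vertex; the repair and parity (W ⊆ V₁) put these two at distance at least 4.

module Submission where

open import Defs
open import Data.Nat using (ℕ; zero; suc; _+_; _*_; _∸_; _≤_; _<_; z≤n; s≤s; pred; _⊔_; _≤ᵇ_)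
open import Data.Nat.Properties hiding (_≟_)
import Data.Nat as ℕ
open import Data.Nat.GeneralisedArithmetic using (iterate; iterate-is-fold)
open import Data.Nat.ListAction using (sum)
open import Data.Nat.Solver using (module +-*-Solver)
open import Data.Bool using (Bool; true; false; _∧_; _∨_; not; if_then_else_; _xor_)
import Data.Bool as Bool
open import Data.Bool.Properties using (¬-not; not-distribˡ-xor; not-distribʳ-xor; ∨-zeroʳ; T-≡)
open import Data.Bool.ListAction using (any)
open import Data.Fin using (Fin; zero; suc; _≟_; toℕ)
import Data.Fin.Properties as Finₚ
open import Data.Fin.Subset as Subset using (Subset; _∩_; _∪_; ⁅_⁆; ∣_∣; ⊥)
import Data.Fin.Subset.Properties as Subsetₚ
open import Data.Vec using (lookup; tabulate; _∷_; [])
import Data.Vec.Properties as Vecₚ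
open import Data.List using (List; []; _∷_; _++_; length; map; allFin; filter; concatMap; foldr)
open import Data.List.Properties using (++-assoc; length-++; length-map; length-tabulate; map-cong-local; concatMap-map)
open import Data.List.Relation.Unary.All as All using (All; []; _∷_)
open import Data.List.Relation.Unary.Any using (here; there; satisfied)
import Data.List.Relation.Unary.Any as Any
open import Data.List.Relation.Unary.Any.Properties using (any⁺; any⁻)
open import Data.List.Relation.Unary.Linked using (Linked; []; [-]; _∷_)
open import Data.List.Relation.Unary.AllPairs using ([]; _∷_)
open import Data.List.Relation.Unary.Unique.Propositional using (Unique)
import Data.List.Relation.Unary.Unique.Propositional.Properties as Uniqueₚ
open import Data.List.Membership.Propositional using (_∈_; find; lose)
open import Data.List.Membership.Propositional.Properties
  using (∈-allFin; ∈-concatMap⁺; ∈-concatMap⁻; ∈-++⁻; ∈-filter⁺; ∈-filter⁻; ∈-map⁺; ∈-map⁻)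
open import Data.Product using (Σ; ∃; _×_; _,_; proj₁; proj₂)
open import Data.Sum using (_⊎_; inj₁; inj₂)
open import Data.Empty renaming (⊥ to Empty) using (⊥-elim)
open import Function using (_∘_; Equivalence)
open import Relation.Nullary using (¬_; Dec; yes; no; ¬?)
open import Relation.Nullary.Decidable using (⌊_⌋; _×-dec_; map′)
open import Relation.Unary using (Decidable)
open import Relation.Binary.PropositionalEquality
open import Relation.Binary.Definitions using (tri<; tri≈; tri>)

open Equivalence using (to; from)

least-witness : {P : ℕ → Set} → Decidable P → ∀ {m} → P m →
                ∃ λ j → P j × j ≤ m × (∀ i → i < j → ¬ P i)
least-witness {P} P? {zero} p = zero , p , z≤n , λ i ()
least-witness {P} P? {suc m} p with P? zero
... | yes p₀ = zero , p₀ , z≤n , λ i ()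
... | no ¬p₀ with least-witness (P? ∘ suc) p
... | j , pj , j≤m , below = suc j , pj , s≤s j≤m , minimal
  where
  minimal : ∀ i → i < suc j → ¬ P i
  minimal zero _ = ¬p₀
  minimal (suc i) (s≤s i<j) = below i i<j

iterate-suc : {A : Set} (f : A → A) (x : A) (i : ℕ) → iterate f x (suc i) ≡ f (iterate f x i)
iterate-suc f x i = trans (sym (iterate-is-fold x f (suc i))) (cong f (iterate-is-fold x f i))

∧-true : ∀ {a b} → (a ∧ b) ≡ true → a ≡ true × b ≡ true
∧-true {true} {true} _ = refl , refl

∨-true : ∀ {a b} → (a ∨ b) ≡ true → a ≡ true ⊎ b ≡ true
∨-true {true} _ = inj₁ refl
∨-true {false} e = inj₂ e

∨-false : ∀ {a b} → (a ∨ b) ≡ false → a ≡ false × b ≡ false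
∨-false {false} {false} _ = refl , refl

∨-trueˡ : ∀ {a} b → a ≡ true → (a ∨ b) ≡ true
∨-trueˡ b refl = refl

∨-trueʳ : ∀ a {b} → b ≡ true → (a ∨ b) ≡ true
∨-trueʳ true refl = refl
∨-trueʳ false refl = refl

not-true : ∀ {a} → not a ≡ true → a ≡ false
not-true {false} _ = refl

true≢false : ∀ {a} → a ≡ true → a ≡ false → Empty
true≢false refl ()

≢true⇒false : ∀ {b} → b ≢ true → b ≡ false
≢true⇒false {false} _ = refl
≢true⇒false {true} ne = ⊥-elim (ne refl)

isYes-yes : ∀ {A : Set} (a? : Dec A) → A → ⌊ a? ⌋ ≡ true
isYes-yes (yes _) _ = refl
isYes-yes (no ¬a) a = ⊥-elim (¬a a)

isYes-no : ∀ {A : Set} (a? : Dec A) → ¬ A → ⌊ a? ⌋ ≡ false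
isYes-no (yes a) ¬a = ⊥-elim (¬a a)
isYes-no (no _) _ = refl

isYes-true : ∀ {A : Set} (a? : Dec A) → ⌊ a? ⌋ ≡ true → A
isYes-true (yes a) _ = a

isYes-false : ∀ {A : Set} (a? : Dec A) → ⌊ a? ⌋ ≡ false → ¬ A
isYes-false (no ¬a) _ = ¬a

module _ {n : ℕ} where

  any-allFin⁺ : (p : Fin n → Bool) (x : Fin n) → p x ≡ true → any p (allFin n) ≡ true
  any-allFin⁺ p x px =
    to T-≡ (any⁺ p (Any.map (λ { refl → from T-≡ px }) (∈-allFin x)))

  any-allFin⁻ : (p : Fin n → Bool) → any p (allFin n) ≡ true → ∃ λ x → p x ≡ true
  any-allFin⁻ p e with satisfied (any⁻ p (allFin n) (from T-≡ e))
  ... | x , px = x , to T-≡ px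

  ∈-tabulate⁺ : (f : Fin n → Bool) (x : Fin n) → f x ≡ true → x Subset.∈ tabulate f
  ∈-tabulate⁺ f x e = Vecₚ.lookup⇒[]= x (tabulate f) (trans (Vecₚ.lookup∘tabulate f x) e)

  ∈-tabulate⁻ : (f : Fin n → Bool) (x : Fin n) → x Subset.∈ tabulate f → f x ≡ true
  ∈-tabulate⁻ f x m = trans (sym (Vecₚ.lookup∘tabulate f x)) (Vecₚ.[]=⇒lookup m)

  lookup⇒∈ : (p : Subset n) (x : Fin n) → lookup p x ≡ true → x Subset.∈ p
  lookup⇒∈ p x = Vecₚ.lookup⇒[]= x p

∣p∪q∣≤∣p∣+∣q∣ : ∀ {n} (p q : Subset n) → ∣ p ∪ q ∣ ≤ ∣ p ∣ + ∣ q ∣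
∣p∪q∣≤∣p∣+∣q∣ [] [] = z≤n
∣p∪q∣≤∣p∣+∣q∣ (true ∷ p) (true ∷ q) = s≤s (≤-trans (∣p∪q∣≤∣p∣+∣q∣ p q) (+-monoʳ-≤ ∣ p ∣ (n≤1+n _)))
∣p∪q∣≤∣p∣+∣q∣ (true ∷ p) (false ∷ q) = s≤s (∣p∪q∣≤∣p∣+∣q∣ p q)
∣p∪q∣≤∣p∣+∣q∣ (false ∷ p) (true ∷ q) =
  subst (suc ∣ p ∪ q ∣ ≤_) (sym (+-suc ∣ p ∣ ∣ q ∣)) (s≤s (∣p∪q∣≤∣p∣+∣q∣ p q))
∣p∪q∣≤∣p∣+∣q∣ (false ∷ p) (false ∷ q) = ∣p∪q∣≤∣p∣+∣q∣ p q

module _ {A : Set} where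

  ∉-tail⇒Unique-∷ : ∀ {x : A} {xs} → (∀ y → y ∈ xs → x ≢ y) → Unique xs → Unique (x ∷ xs)
  ∉-tail⇒Unique-∷ {xs = xs} x∉ u = All.tabulate (λ {y} y∈ → x∉ y y∈) ∷ u

  ++⁺-Unique : (xs ys : List A) → Unique xs → Unique ys →
               (∀ a b → a ∈ xs → b ∈ ys → a ≢ b) → Unique (xs ++ ys)
  ++⁺-Unique xs ys ux uy apart = Uniqueₚ.++⁺ ux uy λ { (a∈ , b∈) → apart _ _ a∈ b∈ refl }

  remove : {x : A} (ys : List A) → x ∈ ys →
           Σ (List A) λ ys' → length ys ≡ suc (length ys') × (∀ z → z ∈ ys → z ≢ x → z ∈ ys')
  remove (y ∷ ys) (here refl) = ys , refl , keep
    where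
    keep : ∀ z → z ∈ y ∷ ys → z ≢ y → z ∈ ys
    keep z (here refl) z≢y = ⊥-elim (z≢y refl)
    keep z (there z∈) _ = z∈
  remove (y ∷ ys) (there x∈) with remove ys x∈
  ... | ys' , len , keep = y ∷ ys' , cong suc len , keep′
    where
    keep′ : ∀ z → z ∈ y ∷ ys → _ → z ∈ y ∷ ys'
    keep′ z (here refl) _ = here refl
    keep′ z (there z∈) z≢x = there (keep z z∈ z≢x)

  Unique⇒length≤ : (xs ys : List A) → Unique xs → (∀ x → x ∈ xs → x ∈ ys) → length xs ≤ length ys
  Unique⇒length≤ [] ys _ _ = z≤n
  Unique⇒length≤ (x ∷ xs) ys (x∉ ∷ u) sub with remove ys (sub x (here refl))
  ... | ys' , len , keep = subst (suc (length xs) ≤_) (sym len)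
      (s≤s (Unique⇒length≤ xs ys' u λ z z∈ → keep z (sub z (there z∈)) λ z≡x → All.lookup x∉ z∈ (sym z≡x)))

  two-distinct⇒2≤length : {x y : A} (xs : List A) → x ∈ xs → y ∈ xs → x ≢ y → 2 ≤ length xs
  two-distinct⇒2≤length (_ ∷ _ ∷ _) _ _ _ = s≤s (s≤s z≤n)
  two-distinct⇒2≤length (_ ∷ []) (here refl) (here refl) x≢y = ⊥-elim (x≢y refl)

module _ {A B : Set} (f : A → List B) where

  ∈-concatMap⁺′ : ∀ {x c} (cs : List A) → c ∈ cs → x ∈ f c → x ∈ concatMap f cs
  ∈-concatMap⁺′ cs c∈ x∈ = ∈-concatMap⁺ f (lose c∈ x∈)

  ∈-concatMap⁻′ : ∀ {x} (cs : List A) → x ∈ concatMap f cs → ∃ λ c → c ∈ cs × x ∈ f c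
  ∈-concatMap⁻′ cs x∈ = find (∈-concatMap⁻ f x∈)

  concatMap⁺-Unique : (cs : List A) → Unique cs → (∀ c → c ∈ cs → Unique (f c)) →
                      (∀ x c₁ c₂ → c₁ ∈ cs → c₂ ∈ cs → x ∈ f c₁ → x ∈ f c₂ → c₁ ≡ c₂) →
                      Unique (concatMap f cs)
  concatMap⁺-Unique [] _ _ _ = []
  concatMap⁺-Unique (c ∷ cs) (c∉ ∷ u) uf apart =
    ++⁺-Unique (f c) (concatMap f cs) (uf c (here refl))
      (concatMap⁺-Unique cs u (λ c' m → uf c' (there m))
        λ x c₁ c₂ m₁ m₂ → apart x c₁ c₂ (there m₁) (there m₂))
      separate
    where
    separate : ∀ a b → a ∈ f c → b ∈ concatMap f cs → a ≢ b
    separate a b a∈ b∈ refl with ∈-concatMap⁻′ cs b∈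
    ... | c' , c'∈ , a∈' = All.lookup c∉ c'∈ (apart a c c' (here refl) (there c'∈) a∈ a∈')

module _ {n : ℕ} {A : Set} where

  ⋃ : List A → (A → Subset n) → Subset n
  ⋃ [] g = ⊥
  ⋃ (a ∷ as) g = g a ∪ ⋃ as g

  ∣⋃∣≤ : (as : List A) (g : A → Subset n) (c : ℕ) → (∀ a → ∣ g a ∣ ≤ c) → ∣ ⋃ as g ∣ ≤ length as * c
  ∣⋃∣≤ [] g c _ = ≤-reflexive (Subsetₚ.∣⊥∣≡0 n)
  ∣⋃∣≤ (a ∷ as) g c bound = ≤-trans (∣p∪q∣≤∣p∣+∣q∣ (g a) (⋃ as g)) (+-mono-≤ (bound a) (∣⋃∣≤ as g c bound))

  ∈-⋃⁺ : (as : List A) (g : A → Subset n) {a : A} {x : Fin n} → a ∈ as → x Subset.∈ g a → x Subset.∈ ⋃ as g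
  ∈-⋃⁺ (a ∷ as) g (here refl) x∈ = Subsetₚ.x∈p∪q⁺ (inj₁ x∈)
  ∈-⋃⁺ (a ∷ as) g (there a∈) x∈ = Subsetₚ.x∈p∪q⁺ (inj₂ (∈-⋃⁺ as g a∈ x∈))

∈⇒≤foldr⊔ : ∀ {y} (ys : List ℕ) → y ∈ ys → y ≤ foldr _⊔_ 0 ys
∈⇒≤foldr⊔ (y ∷ ys) (here refl) = m≤m⊔n y _
∈⇒≤foldr⊔ (y ∷ ys) (there y∈) = ≤-trans (∈⇒≤foldr⊔ ys y∈) (m≤n⊔m y _)

module _ {A : Set} (g : A → Bool) where

  count : List A → ℕ
  count xs = sum (map (λ t → if g t then 1 else 0) xs)

  count≡0 : (xs : List A) → (∀ t → t ∈ xs → g t ≡ false) → count xs ≡ 0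
  count≡0 [] _ = refl
  count≡0 (t ∷ xs) none rewrite none t (here refl) = count≡0 xs λ t' m → none t' (there m)

  count≡1 : (xs : List A) {x : A} → Unique xs → x ∈ xs → g x ≡ true →
            (∀ t → t ∈ xs → g t ≡ true → t ≡ x) → count xs ≡ 1
  count≡1 (t ∷ xs) (t∉ ∷ u) (here refl) gx only rewrite gx = cong suc (count≡0 xs others)
    where
    others : ∀ t' → t' ∈ xs → g t' ≡ false
    others t' t'∈ with g t' in e
    ... | false = refl
    ... | true = ⊥-elim (All.lookup t∉ t'∈ (sym (only t' (there t'∈) e)))
  count≡1 (t ∷ xs) (t∉ ∷ u) (there x∈) gx only with g t in e
  ... | true = ⊥-elim (All.lookup t∉ x∈ (only t (here refl) e))
  ... | false = count≡1 xs u x∈ gx λ t' m e' → only t' (there m) e'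

  count-++ : (xs ys : List A) → count (xs ++ ys) ≡ count xs + count ys
  count-++ [] ys = refl
  count-++ (x ∷ xs) ys = trans (cong ((if g x then 1 else 0) +_) (count-++ xs ys))
                               (sym (+-assoc (if g x then 1 else 0) (count xs) (count ys)))

count-map : {A B : Set} (g : B → Bool) (f : A → B) (xs : List A) → count g (map f xs) ≡ count (g ∘ f) xs
count-map g f [] = refl
count-map g f (x ∷ xs) = cong ((if g (f x) then 1 else 0) +_) (count-map g f xs)

module _ {n : ℕ} (G : Graph n) where

  E-sym : ∀ {u v} → E G u v → E G v u
  E-sym {u} {v} e = trans (Graph.sym G v u) e

  module _ {R : Fin n → Fin n → Set} where

    walk-snoc : ∀ {u v w m} → Walk G R u v m → R v w → Walk G R u w (suc m)
    walk-snoc here r = step r here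
    walk-snoc (step r' p) r = step r' (walk-snoc p r)

    walk-unsnoc : ∀ {u v m} → Walk G R u v (suc m) → ∃ λ w → Walk G R u w m × R w v
    walk-unsnoc (step r here) = _ , here , r
    walk-unsnoc (step r (step r' p)) with walk-unsnoc (step r' p)
    ... | w , p' , r'' = w , step r p' , r''

    walk-reverse : (∀ x y → R x y → R y x) → ∀ {u v m} → Walk G R u v m → Walk G R v u m
    walk-reverse R-sym here = here
    walk-reverse R-sym (step r p) = walk-snoc (walk-reverse R-sym p) (R-sym _ _ r)

    walk-++ : ∀ {u v w m m'} → Walk G R u v m → Walk G R v w m' → Walk G R u w (m + m')
    walk-++ here q = q
    walk-++ (step r p) q = step r (walk-++ p q)

  walk? : ∀ m u v → Dec (Walk G (E G) u v m)
  walk? zero u v with u ≟ v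
  ... | yes refl = yes here
  ... | no u≢v = no λ { here → u≢v refl }
  walk? (suc m) u v =
    map′ (λ (w , e , p) → step e p) (λ { (step e p) → _ , e , p })
         (Finₚ.any? λ w → (Graph.adj G u w Bool.≟ true) ×-dec walk? m w v)

odd : ℕ → Bool
odd zero = false
odd (suc m) = not (odd m)

module RootedTree (k : ℕ) (T : Graph (suc k)) (tree : IsTree T)
                  (χ : Fin (suc k) → Bool) (proper : ProperColouring T χ) where

  n : ℕ
  n = suc k

  open Graph T using (adj)

  root : Fin n
  root = zero

  colour-edge : ∀ {u v} → E T u v → χ v ≡ not (χ u)
  colour-edge {u} {v} e = ¬-not λ χv≡χu → proper u v e (sym χv≡χu)

  colour-walk : ∀ {u v m} → Walk T (E T) u v m → χ v ≡ χ u xor odd m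
  colour-walk {u} here with χ u
  ... | false = refl
  ... | true = refl
  colour-walk {u} {v} (step {v = w} {m = m} e p) = begin
    χ v                      ≡⟨ colour-walk p ⟩
    χ w xor odd m            ≡⟨ cong (_xor odd m) (colour-edge e) ⟩
    not (χ u) xor odd m      ≡⟨ sym (not-distribˡ-xor (χ u) (odd m)) ⟩
    not (χ u xor odd m)      ≡⟨ not-distribʳ-xor (χ u) (odd m) ⟩
    χ u xor not (odd m)      ∎
    where open ≡-Reasoning

  opaque
    depth-spec : ∀ v → ∃ λ d → Walk T (E T) root v d × (∀ i → i < d → ¬ Walk T (E T) root v i)
    depth-spec v with least-witness (λ m → walk? T m root v) (proj₂ (proj₁ tree root v))
    ... | d , p , _ , minimal = d , p , minimal

    depth : Fin n → ℕ
    depth v = proj₁ (depth-spec v)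

    depth-walk : ∀ v → Walk T (E T) root v (depth v)
    depth-walk v = proj₁ (proj₂ (depth-spec v))

    depth-minimal : ∀ v m → Walk T (E T) root v m → depth v ≤ m
    depth-minimal v m p = ≮⇒≥ λ m<d → proj₂ (proj₂ (depth-spec v)) m m<d p

  depth-root : depth root ≡ 0
  depth-root = n≤0⇒n≡0 (depth-minimal root 0 here)

  depth≡0⇒root : ∀ v → depth v ≡ 0 → v ≡ root
  depth≡0⇒root v d≡0 with depth-walk v
  ... | p rewrite d≡0 with p
  ... | here = refl

  0<depth⇒≢root : ∀ v → 0 < depth v → v ≢ root
  0<depth⇒≢root v 0<d refl rewrite depth-root = <-irrefl refl 0<d

  depth-edge≤ : ∀ {u v} → E T u v → depth v ≤ suc (depth u)
  depth-edge≤ {u} {v} e = depth-minimal v _ (walk-snoc T (depth-walk u) e)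

  colour-depth : ∀ v → χ v ≡ χ root xor odd (depth v)
  colour-depth v = colour-walk (depth-walk v)

  depth-edge≢ : ∀ {u v} → E T u v → depth u ≢ depth v
  depth-edge≢ {u} {v} e du≡dv =
    proper u v e (trans (colour-depth u) (trans (cong (λ d → χ root xor odd d) du≡dv) (sym (colour-depth v))))

  depth-edge : ∀ {u v} → E T u v → depth v ≡ suc (depth u) ⊎ depth u ≡ suc (depth v)
  depth-edge {u} {v} e with <-cmp (depth u) (depth v)
  ... | tri< du<dv _ _ = inj₁ (≤-antisym (depth-edge≤ e) du<dv)
  ... | tri≈ _ du≡dv _ = ⊥-elim (depth-edge≢ e du≡dv)
  ... | tri> _ _ dv<du = inj₂ (≤-antisym (depth-edge≤ (E-sym T e)) dv<du)

  IsParent : Fin n → Fin n → Set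
  IsParent v w = E T v w × suc (depth w) ≡ depth v

  IsParent? : ∀ v w → Dec (IsParent v w)
  IsParent? v w = (adj v w Bool.≟ true) ×-dec (suc (depth w) ℕ.≟ depth v)

  opaque
    parent : Fin n → Fin n
    parent v with Finₚ.any? (IsParent? v)
    ... | yes (w , _) = w
    ... | no _ = root

    parent-exists : ∀ v → v ≢ root → ∃ λ w → IsParent v w
    parent-exists v v≢root with depth v in d≡
    ... | zero = ⊥-elim (v≢root (depth≡0⇒root v d≡))
    ... | suc m with walk-unsnoc T (subst (Walk T (E T) root v) d≡ (depth-walk v))
    ... | w , p , e = w , E-sym T e ,
          ≤-antisym (s≤s (depth-minimal w m p)) (subst (_≤ suc (depth w)) d≡ (depth-edge≤ e))

    parent-spec : ∀ v → v ≢ root → IsParent v (parent v)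
    parent-spec v v≢root with Finₚ.any? (IsParent? v)
    ... | yes (w , isParent) = isParent
    ... | no none = ⊥-elim (none (parent-exists v v≢root))

    parent-root : parent root ≡ root
    parent-root with Finₚ.any? (IsParent? root)
    ... | yes (w , _ , d≡) = ⊥-elim (0≢1+n (trans (sym depth-root) (sym d≡)))
    ... | no _ = refl

  parent-edge : ∀ v → v ≢ root → E T v (parent v)
  parent-edge v v≢root = proj₁ (parent-spec v v≢root)

  depth-parent : ∀ v → v ≢ root → suc (depth (parent v)) ≡ depth v
  depth-parent v v≢root = proj₂ (parent-spec v v≢root)

  depth-parent-pred : ∀ v → depth (parent v) ≡ pred (depth v)
  depth-parent-pred v with v ≟ root
  ... | yes refl = trans (cong depth parent-root) (trans depth-root (cong pred (sym depth-root)))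
  ... | no v≢root = cong pred (depth-parent v v≢root)

  depth-parent< : ∀ v → v ≢ root → depth (parent v) < depth v
  depth-parent< v v≢root = subst (depth (parent v) <_) (depth-parent v v≢root) ≤-refl

  depth-parent≤ : ∀ v → depth (parent v) ≤ depth v
  depth-parent≤ v = subst (_≤ depth v) (sym (depth-parent-pred v)) pred[n]≤n

  ancestor : ℕ → Fin n → Fin n
  ancestor i x = iterate parent x i

  ancestor-suc : ∀ i x → ancestor (suc i) x ≡ parent (ancestor i x)
  ancestor-suc i x = iterate-suc parent x i

  depth-ancestor : ∀ i x → depth (ancestor i x) ≡ depth x ∸ i
  depth-ancestor zero x = refl
  depth-ancestor (suc i) x = begin
    depth (ancestor (suc i) x)       ≡⟨ cong depth (ancestor-suc i x) ⟩
    depth (parent (ancestor i x))    ≡⟨ depth-parent-pred (ancestor i x) ⟩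
    pred (depth (ancestor i x))      ≡⟨ cong pred (depth-ancestor i x) ⟩
    pred (depth x ∸ i)               ≡⟨ pred[m∸n]≡m∸[1+n] (depth x) i ⟩
    depth x ∸ suc i                  ∎
    where open ≡-Reasoning

  depth-ancestor≤ : ∀ i x → depth (ancestor i x) ≤ depth x
  depth-ancestor≤ i x = subst (_≤ depth x) (sym (depth-ancestor i x)) (m∸n≤m (depth x) i)

  ancestor-depth-root : ∀ x → ancestor (depth x) x ≡ root
  ancestor-depth-root x = depth≡0⇒root _ (trans (depth-ancestor (depth x) x) (n∸n≡0 (depth x)))

  ancestor-injective : ∀ {x i i'} → i ≤ depth x → i' ≤ depth x →
                       depth (ancestor i x) ≡ depth (ancestor i' x) → i ≡ i'
  ancestor-injective {x} {i} {i'} i≤ i'≤ eq rewrite depth-ancestor i x | depth-ancestor i' x =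
    ∸-cancelˡ-≡ i≤ i'≤ eq

  ancestor-≢root : ∀ {x i} j → j < i → i ≤ depth x → ancestor j x ≢ root
  ancestor-≢root {x} j j<i i≤ =
    0<depth⇒≢root _ (subst (0 <_) (sym (depth-ancestor j x)) (m<n⇒0<n∸m (<-≤-trans j<i i≤)))

  ascent : Fin n → ℕ → List (Fin n)
  ascent x zero = []
  ascent x (suc i) = x ∷ ascent (parent x) i

  descent : Fin n → ℕ → List (Fin n)
  descent y zero = []
  descent y (suc i) = descent (parent y) i ++ y ∷ []

  ∈-ascent : ∀ {z} x i → z ∈ ascent x i → ∃ λ j → j < i × z ≡ ancestor j x
  ∈-ascent x (suc i) (here refl) = 0 , s≤s z≤n , refl
  ∈-ascent x (suc i) (there z∈) with ∈-ascent (parent x) i z∈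
  ... | j , j<i , z≡ = suc j , s≤s j<i , z≡

  ∈-descent : ∀ {z} y i → z ∈ descent y i → ∃ λ j → j < i × z ≡ ancestor j y
  ∈-descent y (suc i) z∈ with ∈-++⁻ (descent (parent y) i) z∈
  ... | inj₂ (here refl) = 0 , s≤s z≤n , refl
  ... | inj₁ z∈′ with ∈-descent (parent y) i z∈′
  ... | j , j<i , z≡ = suc j , s≤s j<i , z≡

  ∈-ascent⇒depth≤ : ∀ {z} x i → z ∈ ascent x i → depth z ≤ depth x
  ∈-ascent⇒depth≤ x i z∈ with ∈-ascent x i z∈
  ... | j , _ , refl = depth-ancestor≤ j x

  ∈-descent⇒depth≤ : ∀ {z} y i → z ∈ descent y i → depth z ≤ depth y
  ∈-descent⇒depth≤ y i z∈ with ∈-descent y i z∈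
  ... | j , _ , refl = depth-ancestor≤ j y

  private
    step-below : ∀ x i → suc i ≤ depth x → x ≢ root × i ≤ depth (parent x) × depth (parent x) < depth x
    step-below x i i<d = x≢root , ≤-pred (subst (suc i ≤_) (sym (depth-parent x x≢root)) i<d) , depth-parent< x x≢root
      where
      x≢root : x ≢ root
      x≢root = 0<depth⇒≢root x (≤-trans (s≤s z≤n) i<d)

  ascent-Unique : ∀ x i → i ≤ depth x → Unique (ascent x i)
  ascent-Unique x zero _ = []
  ascent-Unique x (suc i) i<d with step-below x i i<d
  ... | _ , i≤ , dp<dx = ∉-tail⇒Unique-∷ x∉ (ascent-Unique (parent x) i i≤)
    where
    x∉ : ∀ z → z ∈ ascent (parent x) i → x ≢ z
    x∉ z z∈ refl = <-irrefl refl (≤-<-trans (∈-ascent⇒depth≤ (parent x) i z∈) dp<dx)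

  descent-Unique : ∀ y i → i ≤ depth y → Unique (descent y i)
  descent-Unique y zero _ = []
  descent-Unique y (suc i) i<d with step-below y i i<d
  ... | _ , i≤ , dp<dy = ++⁺-Unique (descent (parent y) i) (y ∷ []) (descent-Unique (parent y) i i≤) ([] ∷ []) y∉
    where
    y∉ : ∀ a b → a ∈ descent (parent y) i → b ∈ y ∷ [] → a ≢ b
    y∉ a b a∈ (here refl) refl = <-irrefl refl (≤-<-trans (∈-descent⇒depth≤ (parent y) i a∈) dp<dy)

  ascent-linked : ∀ x i zs → Linked (E T) (ancestor i x ∷ zs) → (∀ j → j < i → ancestor j x ≢ root) →
                  Linked (E T) (ascent x i ++ ancestor i x ∷ zs)
  ascent-linked x zero zs l _ = l
  ascent-linked x (suc zero) zs l ≢root = parent-edge x (≢root 0 (s≤s z≤n)) ∷ l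
  ascent-linked x (suc (suc i)) zs l ≢root =
    parent-edge x (≢root 0 (s≤s z≤n)) ∷ ascent-linked (parent x) (suc i) zs l (λ j j< → ≢root (suc j) (s≤s j<))

  descent-linked : ∀ y i zs → Linked (E T) (y ∷ zs) → (∀ j → j < i → ancestor j y ≢ root) →
                   Linked (E T) (ancestor i y ∷ descent y i ++ zs)
  descent-linked y zero zs l _ = l
  descent-linked y (suc i) zs l ≢root =
    subst (λ t → Linked (E T) (ancestor i (parent y) ∷ t)) (sym (++-assoc (descent (parent y) i) (y ∷ []) zs))
      (descent-linked (parent y) i (y ∷ zs) (E-sym T (parent-edge y (≢root 0 (s≤s z≤n))) ∷ l)
        λ j j< → ≢root (suc j) (s≤s j<))

  private
    module CommonNeighbourCycle {u y v : Fin n} (vu : E T v u) (yv : E T y v)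
           (du≡dy : depth u ≡ depth y) (du<dv : depth u < depth v) (u≢y : u ≢ y) where

      depth-ancestor-y : ∀ i → depth (ancestor i y) ≡ depth (ancestor i u)
      depth-ancestor-y i = trans (depth-ancestor i y) (trans (cong (_∸ i) (sym du≡dy)) (sym (depth-ancestor i u)))

      meet-at-root : ancestor (depth u) u ≡ ancestor (depth u) y
      meet-at-root = trans (ancestor-depth-root u)
        (sym (depth≡0⇒root _ (trans (depth-ancestor-y (depth u)) (trans (depth-ancestor (depth u) u) (n∸n≡0 (depth u))))))

      meet : ∃ λ j → ancestor j u ≡ ancestor j y × j ≤ depth u × (∀ i → i < j → ancestor i u ≢ ancestor i y)
      meet = least-witness (λ j → ancestor j u ≟ ancestor j y) meet-at-root

      j : ℕ
      j = proj₁ meet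

      j≤du : j ≤ depth u
      j≤du = proj₁ (proj₂ (proj₂ meet))

      j≤dy : j ≤ depth y
      j≤dy = subst (j ≤_) du≡dy j≤du

      below-meet : ∀ i → i < j → ancestor i u ≢ ancestor i y
      below-meet = proj₂ (proj₂ (proj₂ meet))

      same-index : ∀ {i i'} → i ≤ j → i' ≤ j → ancestor i u ≡ ancestor i' y → i ≡ i'
      same-index {i} {i'} i≤ i'≤ eq =
        ancestor-injective (≤-trans i≤ j≤du) (≤-trans i'≤ j≤du) (trans (cong depth eq) (depth-ancestor-y i'))

      m : Fin n
      m = ancestor j u

      path : List (Fin n)
      path = ascent u j ++ m ∷ descent y j

      path-linked : Linked (E T) (v ∷ path ++ v ∷ [])
      path-linked with j | proj₁ (proj₂ meet) | j≤du | j≤dy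
      ... | zero | u≡y | _ | _ = ⊥-elim (u≢y u≡y)
      ... | suc i | meets | ≤du | ≤dy =
        subst (λ t → Linked (E T) (v ∷ t)) (sym (++-assoc (ascent u (suc i)) (_ ∷ descent y (suc i)) (v ∷ [])))
          (vu ∷ ascent-linked u (suc i) (descent y (suc i) ++ v ∷ [])
                  (subst (λ t → Linked (E T) (t ∷ descent y (suc i) ++ v ∷ [])) (sym meets)
                    (descent-linked y (suc i) (v ∷ []) (yv ∷ [-]) λ i' i'< → ancestor-≢root i' i'< ≤dy))
                  λ i' i'< → ancestor-≢root i' i'< ≤du)

      path-length : 2 ≤ length path
      path-length with j | proj₁ (proj₂ meet)
      ... | zero | u≡y = ⊥-elim (u≢y u≡y)
      ... | suc i | _ = s≤s (lemma (ascent (parent u) i))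
        where
        lemma : (ws : List (Fin n)) → 1 ≤ length (ws ++ ancestor (suc i) u ∷ descent y (suc i))
        lemma [] = s≤s z≤n
        lemma (_ ∷ _) = s≤s z≤n

      ∈-path⇒depth≤ : ∀ b → b ∈ path → depth b ≤ depth u
      ∈-path⇒depth≤ b b∈ with ∈-++⁻ (ascent u j) b∈
      ... | inj₁ b∈↑ = ∈-ascent⇒depth≤ u j b∈↑
      ... | inj₂ (here refl) = depth-ancestor≤ j u
      ... | inj₂ (there b∈↓) = subst (depth b ≤_) (sym du≡dy) (∈-descent⇒depth≤ y j b∈↓)

      path-Unique : Unique path
      path-Unique = ++⁺-Unique (ascent u j) (m ∷ descent y j) (ascent-Unique u j j≤du)
        (∉-tail⇒Unique-∷ m∉ (descent-Unique y j j≤dy)) apart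
        where
        m∉ : ∀ b → b ∈ descent y j → m ≢ b
        m∉ b b∈ m≡b with ∈-descent y j b∈
        ... | i , i<j , refl = <-irrefl (sym (same-index ≤-refl (<⇒≤ i<j) m≡b)) i<j
        apart : ∀ a b → a ∈ ascent u j → b ∈ m ∷ descent y j → a ≢ b
        apart a b a∈ b∈ a≡b with ∈-ascent u j a∈
        apart a b a∈ (here refl) a≡b | i , i<j , refl = <-irrefl (same-index (<⇒≤ i<j) ≤-refl (trans a≡b meet-eq)) i<j
          where meet-eq = proj₁ (proj₂ meet)
        apart a b a∈ (there b∈) a≡b | i , i<j , refl with ∈-descent y j b∈
        ... | i' , i'<j , refl =
          below-meet i i<j (trans a≡b (cong (λ t → ancestor t y) (sym (same-index {i} {i'} (<⇒≤ i<j) (<⇒≤ i'<j) a≡b))))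

      cycle : HasCycle T
      cycle = v , path , ∉-tail⇒Unique-∷ v∉ path-Unique , path-length , path-linked
        where
        v∉ : ∀ b → b ∈ path → v ≢ b
        v∉ b b∈ refl = <-irrefl refl (<-≤-trans du<dv (∈-path⇒depth≤ b b∈))

  edge-down⇒child : ∀ {u v} → E T u v → depth v ≡ suc (depth u) → parent v ≡ u
  edge-down⇒child {u} {v} e dv≡ with parent v ≟ u
  ... | yes pv≡u = pv≡u
  ... | no pv≢u = ⊥-elim (proj₂ tree (CommonNeighbourCycle.cycle (E-sym T e) (E-sym T (parent-edge v v≢root))
                                        du≡dp (subst (depth u <_) (sym dv≡) ≤-refl) (≢-sym pv≢u)))
    where
    v≢root : v ≢ root
    v≢root = 0<depth⇒≢root v (subst (0 <_) (sym dv≡) (s≤s z≤n))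
    du≡dp : depth u ≡ depth (parent v)
    du≡dp = suc-injective (trans (sym dv≡) (sym (depth-parent v v≢root)))

  edge-parent : ∀ {u v} → E T u v → (v ≢ root × parent v ≡ u) ⊎ (u ≢ root × parent u ≡ v)
  edge-parent {u} {v} e with depth-edge e
  ... | inj₁ dv≡ = inj₁ (0<depth⇒≢root v (subst (0 <_) (sym dv≡) (s≤s z≤n)) , edge-down⇒child e dv≡)
  ... | inj₂ du≡ = inj₂ (0<depth⇒≢root u (subst (0 <_) (sym du≡) (s≤s z≤n)) , edge-down⇒child (E-sym T e) du≡)

  depth<n : ∀ v → depth v < n
  depth<n v = Finₚ.injective⇒≤ {f = λ i → ancestor (toℕ i) v} injective
    where
    injective : ∀ {i i'} → ancestor (toℕ i) v ≡ ancestor (toℕ i') v → i ≡ i'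
    injective {i} {i'} eq = Finₚ.toℕ-injective
      (ancestor-injective (≤-pred (Finₚ.toℕ<n i)) (≤-pred (Finₚ.toℕ<n i')) (cong depth eq))

potential-+ : ∀ ℓ a x b d a' x' b' d' → ℓ * (a + x) + 2 * b ≤ 2 * d → ℓ * (a' + x') + 2 * b' ≤ 2 * d' →
              ℓ * ((a + a') + (x + x')) + 2 * (b + b') ≤ 2 * (d + d')
potential-+ ℓ a x b d a' x' b' d' p p' = subst₂ _≤_ (sym lhs) (sym (*-distribˡ-+ 2 d d')) (+-mono-≤ p p')
  where
  open +-*-Solver
  lhs : ℓ * ((a + a') + (x + x')) + 2 * (b + b') ≡ (ℓ * (a + x) + 2 * b) + (ℓ * (a' + x') + 2 * b')
  lhs = solve 7 (λ L a a' x x' b b' → L :* ((a :+ a') :+ (x :+ x')) :+ con 2 :* (b :+ b')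
                   := (L :* (a :+ x) :+ con 2 :* b) :+ (L :* (a' :+ x') :+ con 2 :* b')) refl ℓ a a' x x' b b'

potential-extend : ∀ ℓ a x b d → ℓ * (a + x) + 2 * b ≤ 2 * d → ℓ * (a + x) + 2 * suc b ≤ 2 * suc d
potential-extend ℓ a x b d p = begin
  ℓ * (a + x) + 2 * suc b       ≡⟨ cong (ℓ * (a + x) +_) (*-suc 2 b) ⟩
  ℓ * (a + x) + (2 + 2 * b)     ≡⟨ +-comm (ℓ * (a + x)) (2 + 2 * b) ⟩
  2 + 2 * b + ℓ * (a + x)       ≡⟨ +-assoc 2 (2 * b) (ℓ * (a + x)) ⟩
  2 + (2 * b + ℓ * (a + x))     ≡⟨ cong (2 +_) (+-comm (2 * b) (ℓ * (a + x))) ⟩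
  2 + (ℓ * (a + x) + 2 * b)     ≤⟨ +-monoʳ-≤ 2 p ⟩
  2 + 2 * d                     ≡⟨ sym (*-suc 2 d) ⟩
  2 * suc d                     ∎
  where open ≤-Reasoning

potential-close : ∀ ℓ a x b d → ℓ * (a + x) + 2 * b ≤ 2 * d → ℓ ≤ suc b ⊎ 2 ≤ x →
                  ℓ * (suc a + 1) + 2 * 0 ≤ 2 * suc d
potential-close ℓ a x b d p large = subst (_≤ 2 * suc d) (sym closed) (by large)
  where
  open ≤-Reasoning
  open +-*-Solver
  closed : ℓ * (suc a + 1) + 2 * 0 ≡ ℓ * a + 2 * ℓ
  closed = solve 2 (λ L a → L :* ((con 1 :+ a) :+ con 1) :+ con 2 :* con 0 := L :* a :+ con 2 :* L) refl ℓ a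
  by : ℓ ≤ suc b ⊎ 2 ≤ x → ℓ * a + 2 * ℓ ≤ 2 * suc d
  by (inj₁ ℓ≤1+b) = begin
    ℓ * a + 2 * ℓ             ≤⟨ +-mono-≤ (*-monoʳ-≤ ℓ (m≤m+n a x)) (*-monoʳ-≤ 2 ℓ≤1+b) ⟩
    ℓ * (a + x) + 2 * suc b   ≤⟨ potential-extend ℓ a x b d p ⟩
    2 * suc d                 ∎
  by (inj₂ 2≤x) = begin
    ℓ * a + 2 * ℓ             ≡⟨ cong (ℓ * a +_) (*-comm 2 ℓ) ⟩
    ℓ * a + ℓ * 2             ≤⟨ +-monoʳ-≤ (ℓ * a) (*-monoʳ-≤ ℓ 2≤x) ⟩
    ℓ * a + ℓ * x             ≡⟨ sym (*-distribˡ-+ ℓ a x) ⟩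
    ℓ * (a + x)               ≤⟨ m≤m+n _ _ ⟩
    ℓ * (a + x) + 2 * b       ≤⟨ p ⟩
    2 * d                     ≤⟨ *-monoʳ-≤ 2 (n≤1+n d) ⟩
    2 * suc d                 ∎

-- The paper's constant 336 leaves ample room: the charging argument gives 12.
W-size-bound : ∀ k Δ L w ℓ → 1 ≤ k → w ≤ L * (1 + (Δ + (Δ + Δ))) → ℓ * L ≤ 2 * suc k → w * ℓ ≤ 336 * k * (1 + Δ)
W-size-bound k Δ L w ℓ 1≤k w≤ ℓL≤ = begin
  w * ℓ                              ≤⟨ *-monoˡ-≤ ℓ w≤ ⟩
  L * (1 + (Δ + (Δ + Δ))) * ℓ        ≡⟨ solve 3 (λ L c ℓ → L :* c :* ℓ := (ℓ :* L) :* c) refl L (1 + (Δ + (Δ + Δ))) ℓ ⟩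
  ℓ * L * (1 + (Δ + (Δ + Δ)))        ≤⟨ *-monoˡ-≤ (1 + (Δ + (Δ + Δ))) (≤-trans ℓL≤ (2[1+k]≤4k k 1≤k)) ⟩
  4 * k * (1 + (Δ + (Δ + Δ)))        ≤⟨ *-monoʳ-≤ (4 * k) (+-monoˡ-≤ (Δ + (Δ + Δ)) (m≤m+n 1 2)) ⟩
  4 * k * (3 + (Δ + (Δ + Δ)))        ≡⟨ solve 2 (λ k Δ → con 4 :* k :* (con 3 :+ (Δ :+ (Δ :+ Δ))) := con 12 :* k :* (con 1 :+ Δ)) refl k Δ ⟩
  12 * k * (1 + Δ)                   ≤⟨ *-monoˡ-≤ (1 + Δ) (*-monoˡ-≤ k (m≤m+n 12 324)) ⟩
  336 * k * (1 + Δ)                  ∎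
  where
  open ≤-Reasoning
  open +-*-Solver
  2[1+k]≤4k : ∀ k → 1 ≤ k → 2 * suc k ≤ 4 * k
  2[1+k]≤4k k 1≤k = subst (2 * suc k ≤_) (solve 1 (λ k → con 2 :* (k :+ k) := con 4 :* k) refl k)
                          (*-monoʳ-≤ 2 (+-monoˡ-≤ k 1≤k))

P-size-bound : ∀ k L p ℓ → 1 ≤ k → p ≤ 3 * L → ℓ * L ≤ 2 * suc k → p * ℓ ≤ 336 * k
P-size-bound k L p ℓ 1≤k p≤ ℓL≤ = begin
  p * ℓ              ≤⟨ *-monoˡ-≤ ℓ p≤ ⟩
  3 * L * ℓ          ≡⟨ solve 2 (λ L ℓ → con 3 :* L :* ℓ := con 3 :* (ℓ :* L)) refl L ℓ ⟩
  3 * (ℓ * L)        ≤⟨ *-monoʳ-≤ 3 ℓL≤ ⟩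
  3 * (2 * suc k)    ≡⟨ solve 1 (λ k → con 3 :* (con 2 :* (con 1 :+ k)) := con 6 :+ con 6 :* k) refl k ⟩
  6 + 6 * k          ≤⟨ +-monoˡ-≤ (6 * k) (*-monoʳ-≤ 6 1≤k) ⟩
  6 * k + 6 * k      ≡⟨ solve 1 (λ k → con 6 :* k :+ con 6 :* k := con 12 :* k) refl k ⟩
  12 * k             ≤⟨ *-monoˡ-≤ k (m≤m+n 12 324) ⟩
  336 * k            ∎
  where
  open ≤-Reasoning
  open +-*-Solver

module Marking (k : ℕ) (T : Graph (suc k)) (tree : IsTree T)
               (χ : Fin (suc k) → Bool) (proper : ProperColouring T χ) (ℓ : ℕ) where

  open RootedTree k T tree χ proper public

  IsChild : Fin n → Fin n → Set
  IsChild v c = c ≢ root × parent c ≡ v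

  IsChild? : ∀ v c → Dec (IsChild v c)
  IsChild? v c = ¬? (c ≟ root) ×-dec (parent c ≟ v)

  children : Fin n → List (Fin n)
  children v = filter (IsChild? v) (allFin n)

  ∈-children⁺ : ∀ {v c} → c ≢ root → parent c ≡ v → c ∈ children v
  ∈-children⁺ {v} {c} c≢root pc≡v = ∈-filter⁺ (IsChild? v) (∈-allFin c) (c≢root , pc≡v)

  ∈-children⁻ : ∀ {v c} → c ∈ children v → IsChild v c
  ∈-children⁻ {v} c∈ = proj₂ (∈-filter⁻ (IsChild? v) {xs = allFin n} c∈)

  depth-child : ∀ {v c} → c ∈ children v → depth c ≡ suc (depth v)
  depth-child {v} {c} c∈ with ∈-children⁻ c∈
  ... | c≢root , refl = sym (depth-parent c c≢root)

  -- The summary of the subtree of v: component holds the unmarked vertices joined to v through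
  -- unmarked vertices, exits the marked vertices hanging off that component, cuts all marked vertices.
  record Summary : Set where
    constructor summary⟨_,_,_,_,_⟩
    field
      mark      : Bool
      cuts      : List (Fin n)
      component : List (Fin n)
      exits     : List (Fin n)
      visited   : List (Fin n)
  open Summary public

  Child : Set
  Child = Fin n × Summary

  exitsSeenFrom : Child → List (Fin n)
  exitsSeenFrom (c , s) = if mark s then c ∷ [] else exits s

  Σcuts Σcomponent Σexits Σvisited : List Child → List (Fin n)
  Σcuts = concatMap (cuts ∘ proj₂)
  Σcomponent = concatMap (component ∘ proj₂)
  Σexits = concatMap exitsSeenFrom
  Σvisited = concatMap (visited ∘ proj₂)

  mustMark : List Child → Bool
  mustMark cs = (ℓ ≤ᵇ suc (length (Σcomponent cs))) ∨ (2 ≤ᵇ length (Σexits cs))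

  combine : Fin n → List Child → Summary
  combine v cs = if mustMark cs
    then summary⟨ true , v ∷ Σcuts cs , [] , [] , v ∷ Σvisited cs ⟩
    else summary⟨ false , Σcuts cs , v ∷ Σcomponent cs , Σexits cs , v ∷ Σvisited cs ⟩

  -- Every marked vertex is paid for by ℓ/2 visited vertices: it closes a component of size ℓ
  -- or merges two exits, each of which had been paid for already.
  Potential : Child → Set
  Potential c = ℓ * (length (cuts (proj₂ c)) + length (exitsSeenFrom c)) + 2 * length (component (proj₂ c))
                ≤ 2 * length (visited (proj₂ c))

  Σpotential : ∀ cs → All Potential cs →
    ℓ * (length (Σcuts cs) + length (Σexits cs)) + 2 * length (Σcomponent cs) ≤ 2 * length (Σvisited cs)
  Σpotential [] [] = ≤-reflexive (cong (_+ 0) (*-zeroʳ ℓ))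
  Σpotential (c@(_ , s) ∷ cs) (p ∷ ps)
    rewrite length-++ (cuts s) {Σcuts cs} | length-++ (exitsSeenFrom c) {Σexits cs}
          | length-++ (component s) {Σcomponent cs} | length-++ (visited s) {Σvisited cs} =
    potential-+ ℓ (length (cuts s)) (length (exitsSeenFrom c)) (length (component s)) (length (visited s))
      (length (Σcuts cs)) (length (Σexits cs)) (length (Σcomponent cs)) (length (Σvisited cs)) p (Σpotential cs ps)

  mustMark-reason : ∀ cs → mustMark cs ≡ true → ℓ ≤ suc (length (Σcomponent cs)) ⊎ 2 ≤ length (Σexits cs)
  mustMark-reason cs e with ∨-true {ℓ ≤ᵇ suc (length (Σcomponent cs))} e
  ... | inj₁ e₁ = inj₁ (≤ᵇ⇒≤ ℓ _ (subst Bool.T (sym e₁) _))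
  ... | inj₂ e₂ = inj₂ (≤ᵇ⇒≤ 2 _ (subst Bool.T (sym e₂) _))

  potential-combine : ∀ v cs → All Potential cs → Potential (v , combine v cs)
  potential-combine v cs ps with mustMark cs in must
  ... | false = potential-extend ℓ (length (Σcuts cs)) (length (Σexits cs)) (length (Σcomponent cs))
                  (length (Σvisited cs)) (Σpotential cs ps)
  ... | true = potential-close ℓ (length (Σcuts cs)) (length (Σexits cs)) (length (Σcomponent cs))
                 (length (Σvisited cs)) (Σpotential cs ps) (mustMark-reason cs must)

  summaryWithin : ℕ → Fin n → Summary
  summaryWithin zero v = summary⟨ false , [] , [] , [] , [] ⟩
  summaryWithin (suc fuel) v = combine v (map (λ c → c , summaryWithin fuel c) (children v))

  potential-summaryWithin : ∀ fuel v → Potential (v , summaryWithin fuel v)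
  potential-summaryWithin zero v = ≤-reflexive (cong (_+ 0) (*-zeroʳ ℓ))
  potential-summaryWithin (suc fuel) v = potential-combine v _ (all (children v))
    where
    all : ∀ cs → All Potential (map (λ c → c , summaryWithin fuel c) cs)
    all [] = []
    all (c ∷ cs) = potential-summaryWithin fuel c ∷ all cs

  visited-combine : ∀ v cs → visited (combine v cs) ≡ v ∷ Σvisited cs
  visited-combine v cs with mustMark cs
  ... | true = refl
  ... | false = refl

  visited⇒descendant : ∀ fuel v x → x ∈ visited (summaryWithin fuel v) → ∃ λ i → ancestor i x ≡ v
  visited⇒descendant (suc fuel) v x x∈ rewrite visited-combine v (map (λ c → c , summaryWithin fuel c) (children v))
    with x∈
  ... | here refl = 0 , refl
  ... | there x∈′ with ∈-concatMap⁻′ (visited ∘ proj₂) (map (λ c → c , summaryWithin fuel c) (children v)) x∈′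
  ... | _ , c∈′ , x∈c with ∈-map⁻ (λ c → c , summaryWithin fuel c) c∈′
  ... | c , c∈ , refl with visited⇒descendant fuel c x x∈c
  ... | i , ancestor≡c = suc i , trans (ancestor-suc i x) (trans (cong parent ancestor≡c) (proj₂ (∈-children⁻ c∈)))

  visited-Unique : ∀ fuel v → Unique (visited (summaryWithin fuel v))
  visited-Unique zero v = []
  visited-Unique (suc fuel) v
    rewrite visited-combine v (map (λ c → c , summaryWithin fuel c) (children v))
          | concatMap-map (visited ∘ proj₂) (λ c → c , summaryWithin fuel c) (children v) =
    ∉-tail⇒Unique-∷ v∉
      (concatMap⁺-Unique (λ c → visited (summaryWithin fuel c)) (children v)
        (Uniqueₚ.filter⁺ (IsChild? v) (Uniqueₚ.allFin⁺ n)) (λ c _ → visited-Unique fuel c) disjoint)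
    where
    v∉ : ∀ b → b ∈ concatMap (λ c → visited (summaryWithin fuel c)) (children v) → v ≢ b
    v∉ b b∈ refl with ∈-concatMap⁻′ (λ c → visited (summaryWithin fuel c)) (children v) b∈
    ... | c , c∈ , v∈c with visited⇒descendant fuel c v v∈c
    ... | i , refl = <-irrefl refl (≤-<-trans (depth-ancestor≤ i v) (subst (depth v <_) (sym (depth-child c∈)) ≤-refl))
    disjoint : ∀ x c₁ c₂ → c₁ ∈ children v → c₂ ∈ children v →
               x ∈ visited (summaryWithin fuel c₁) → x ∈ visited (summaryWithin fuel c₂) → c₁ ≡ c₂
    disjoint x c₁ c₂ c₁∈ c₂∈ x∈₁ x∈₂ with visited⇒descendant fuel c₁ x x∈₁ | visited⇒descendant fuel c₂ x x∈₂
    ... | i₁ , refl | i₂ , refl = cong (λ i → ancestor i x) (∸-cancelˡ-≡ (index≤ i₁ c₁∈) (index≤ i₂ c₂∈) same-depth)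
      where
      index≤ : ∀ i → ancestor i x ∈ children v → i ≤ depth x
      index≤ i c∈ = ≮⇒≥ λ dx<i → 0≢1+n (trans (sym (m≤n⇒m∸n≡0 (<⇒≤ dx<i)))
                      (trans (sym (depth-ancestor i x)) (depth-child c∈)))
      same-depth : depth x ∸ i₁ ≡ depth x ∸ i₂
      same-depth = trans (sym (depth-ancestor i₁ x))
                     (trans (depth-child c₁∈) (trans (sym (depth-child c₂∈)) (depth-ancestor i₂ x)))

  visited-length : ∀ fuel v → length (visited (summaryWithin fuel v)) ≤ n
  visited-length fuel v = subst (length (visited (summaryWithin fuel v)) ≤_) (length-tabulate {n = n} (λ x → x))
    (Unique⇒length≤ _ (allFin n) (visited-Unique fuel v) λ x _ → ∈-allFin x)

  opaque
    summary : Fin n → Summary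
    summary v = summaryWithin (n ∸ depth v) v

    summary-unfold : ∀ v → summary v ≡ combine v (map (λ c → c , summary c) (children v))
    summary-unfold v = trans (cong (λ fuel → summaryWithin fuel v) (+-∸-assoc 1 (≤-pred (depth<n v))))
                             (cong (combine v) (map-cong-local (All.tabulate same-fuel)))
      where
      same-fuel : ∀ {c} → c ∈ children v → (c , summaryWithin (k ∸ depth v) c) ≡ (c , summary c)
      same-fuel {c} c∈ = cong (λ fuel → c , summaryWithin fuel c) (cong (n ∸_) (sym (depth-child c∈)))

    potential-summary : ∀ v → Potential (v , summary v)
    potential-summary v = potential-summaryWithin (n ∸ depth v) v

    visited-summary-length : ∀ v → length (visited (summary v)) ≤ n
    visited-summary-length v = visited-length (n ∸ depth v) v

  cuts-combine⁺ : ∀ v cs {y} → y ∈ Σcuts cs → y ∈ cuts (combine v cs)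
  cuts-combine⁺ v cs y∈ with mustMark cs
  ... | true = there y∈
  ... | false = y∈

  marked-combine : ∀ v cs → mark (combine v cs) ≡ true → v ∈ cuts (combine v cs)
  marked-combine v cs e with mustMark cs
  ... | true = here refl

  unmarked-combine : ∀ v cs → mark (combine v cs) ≡ false →
    component (combine v cs) ≡ v ∷ Σcomponent cs × exits (combine v cs) ≡ Σexits cs ×
    length (component (combine v cs)) < ℓ × length (exits (combine v cs)) < 2
  unmarked-combine v cs e with mustMark cs in must
  ... | false with ∨-false {ℓ ≤ᵇ suc (length (Σcomponent cs))} must
  ... | small , few = refl , refl , ≰⇒> (λ ℓ≤ → true≢false (to T-≡ (≤⇒≤ᵇ ℓ≤)) small) ,
                      ≰⇒> (λ 2≤ → true≢false (to T-≡ (≤⇒≤ᵇ 2≤)) few)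

  childSummaries : Fin n → List Child
  childSummaries v = map (λ c → c , summary c) (children v)

  marked : Fin n → Bool
  marked v = mark (summary v)

  ∈-childSummaries : ∀ {v c} → c ∈ children v → (c , summary c) ∈ childSummaries v
  ∈-childSummaries = ∈-map⁺ (λ c → c , summary c)

  marked-unfold : ∀ v → mark (combine v (childSummaries v)) ≡ marked v
  marked-unfold v = cong mark (sym (summary-unfold v))

  marked⇒∈cuts : ∀ v → marked v ≡ true → v ∈ cuts (summary v)
  marked⇒∈cuts v e = subst (λ s → v ∈ cuts s) (sym (summary-unfold v))
    (marked-combine v (childSummaries v) (trans (marked-unfold v) e))

  cuts-parent : ∀ x {y} → y ∈ cuts (summary x) → y ∈ cuts (summary (parent x))
  cuts-parent x y∈ with x ≟ root
  ... | yes refl = subst (λ z → _ ∈ cuts (summary z)) (sym parent-root) y∈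
  ... | no x≢root = subst (λ s → _ ∈ cuts s) (sym (summary-unfold (parent x)))
      (cuts-combine⁺ (parent x) (childSummaries (parent x))
        (∈-concatMap⁺′ (cuts ∘ proj₂) (childSummaries (parent x)) (∈-childSummaries (∈-children⁺ x≢root refl)) y∈))

  cuts-ancestor : ∀ i x {y} → y ∈ cuts (summary x) → y ∈ cuts (summary (ancestor i x))
  cuts-ancestor zero x y∈ = y∈
  cuts-ancestor (suc i) x y∈ = cuts-ancestor i (parent x) (cuts-parent x y∈)

  marked⇒∈cuts-root : ∀ v → marked v ≡ true → v ∈ cuts (summary root)
  marked⇒∈cuts-root v e =
    subst (λ z → v ∈ cuts (summary z)) (ancestor-depth-root v) (cuts-ancestor (depth v) v (marked⇒∈cuts v e))

  unmarked-summary : ∀ v → marked v ≡ false →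
    component (summary v) ≡ v ∷ Σcomponent (childSummaries v) × exits (summary v) ≡ Σexits (childSummaries v) ×
    length (component (summary v)) < ℓ × length (exits (summary v)) < 2
  unmarked-summary v e = subst Unmarked (sym (summary-unfold v))
    (unmarked-combine v (childSummaries v) (trans (marked-unfold v) e))
    where
    Unmarked : Summary → Set
    Unmarked s = component s ≡ v ∷ Σcomponent (childSummaries v) × exits s ≡ Σexits (childSummaries v) ×
                 length (component s) < ℓ × length (exits s) < 2

  unmarked⇒∈component : ∀ v → marked v ≡ false → v ∈ component (summary v)
  unmarked⇒∈component v e rewrite proj₁ (unmarked-summary v e) = here refl

  component-parent : ∀ x {y} → x ≢ root → marked x ≡ false → marked (parent x) ≡ false →
                     y ∈ component (summary x) → y ∈ component (summary (parent x))
  component-parent x x≢root _ e y∈ rewrite proj₁ (unmarked-summary (parent x) e) =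
    there (∈-concatMap⁺′ (component ∘ proj₂) (childSummaries (parent x)) (∈-childSummaries (∈-children⁺ x≢root refl)) y∈)

  exits-parent : ∀ x {y} → x ≢ root → marked x ≡ false → marked (parent x) ≡ false →
                 y ∈ exits (summary x) → y ∈ exits (summary (parent x))
  exits-parent x {y} x≢root ex e y∈ rewrite proj₁ (proj₂ (unmarked-summary (parent x) e)) =
    ∈-concatMap⁺′ exitsSeenFrom (childSummaries (parent x)) (∈-childSummaries (∈-children⁺ x≢root refl))
      (subst (λ b → y ∈ (if b then x ∷ [] else exits (summary x))) (sym ex) y∈)

  marked⇒exit-of-parent : ∀ q → q ≢ root → marked q ≡ true → marked (parent q) ≡ false →
                          q ∈ exits (summary (parent q))
  marked⇒exit-of-parent q q≢root eq ep rewrite proj₁ (proj₂ (unmarked-summary (parent q) ep)) =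
    ∈-concatMap⁺′ exitsSeenFrom (childSummaries (parent q)) (∈-childSummaries (∈-children⁺ q≢root refl))
      (subst (λ b → q ∈ (if b then q ∷ [] else exits (summary q))) (sym eq) (here refl))

  marked-count : ℓ * length (cuts (summary root)) ≤ 2 * n
  marked-count = begin
    ℓ * length (cuts (summary root))                                          ≤⟨ *-monoʳ-≤ ℓ (m≤m+n _ _) ⟩
    ℓ * (length (cuts (summary root)) + length (exitsSeenFrom (root , summary root)))  ≤⟨ m≤m+n _ _ ⟩
    _                                                                         ≤⟨ potential-summary root ⟩
    2 * length (visited (summary root))                                       ≤⟨ *-monoʳ-≤ 2 (visited-summary-length root) ⟩
    2 * n                                                                     ∎
    where open ≤-Reasoning

module Partition (k : ℕ) (T : Graph (suc k)) (tree : IsTree T)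
                 (χ : Fin (suc k) → Bool) (proper : ProperColouring T χ) (ℓ : ℕ) where

  open Marking k T tree χ proper ℓ public
  open Graph T using (adj)

  AtTop : (Fin n → Bool) → Fin n → Set
  AtTop X v = v ≡ root ⊎ X (parent v) ≡ true

  climb : (Fin n → Bool) → ℕ → Fin n → Fin n
  climb X zero v = v
  climb X (suc fuel) v = if ⌊ v ≟ root ⌋ ∨ X (parent v) then v else climb X fuel (parent v)

  top : (Fin n → Bool) → Fin n → Fin n
  top X v = climb X (depth v) v

  top-AtTop : ∀ X v → AtTop X v → top X v ≡ v
  top-AtTop X v at with depth v
  ... | zero = refl
  ... | suc _ with at
  ... | inj₁ v≡root rewrite isYes-yes (v ≟ root) v≡root = refl
  ... | inj₂ Xp rewrite Xp | ∨-zeroʳ ⌊ v ≟ root ⌋ = refl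

  top-parent : ∀ X v → v ≢ root → X (parent v) ≡ false → top X v ≡ top X (parent v)
  top-parent X v v≢root ¬Xp with depth v | depth-parent v v≢root
  ... | .(suc (depth (parent v))) | refl rewrite isYes-no (v ≟ root) v≢root | ¬Xp = refl

  top-induction : (X : Fin n → Bool) (P : Fin n → Fin n → Set) →
                  (∀ v → AtTop X v → P v v) →
                  (∀ v → v ≢ root → X (parent v) ≡ false → P (parent v) (top X (parent v)) → P v (top X (parent v))) →
                  ∀ v → P v (top X v)
  top-induction X P base climb-step v = go (depth v) v refl
    where
    go : ∀ d v → depth v ≡ d → P v (top X v)
    go d v dv with v ≟ root
    ... | yes v≡root = subst (P v) (sym (top-AtTop X v (inj₁ v≡root))) (base v (inj₁ v≡root))
    ... | no v≢root with X (parent v) in Xp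
    ... | true = subst (P v) (sym (top-AtTop X v (inj₂ Xp))) (base v (inj₂ Xp))
    go zero v dv | no v≢root | false = ⊥-elim (v≢root (depth≡0⇒root v dv))
    go (suc d) v dv | no v≢root | false =
      subst (P v) (sym (top-parent X v v≢root Xp))
        (climb-step v v≢root Xp (go d (parent v) (suc-injective (trans (depth-parent v v≢root) dv))))

  AtTop-top : ∀ X v → AtTop X (top X v)
  AtTop-top X = top-induction X (λ _ t → AtTop X t) (λ _ at → at) (λ _ _ _ at → at)

  top-∉ : ∀ X v → X v ≡ false → X (top X v) ≡ false
  top-∉ X = top-induction X (λ v t → X v ≡ false → X t ≡ false) (λ _ _ ¬X → ¬X) (λ _ _ ¬Xp ih _ → ih ¬Xp)

  top-idem : ∀ X v → top X (top X v) ≡ top X v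
  top-idem X v = top-AtTop X (top X v) (AtTop-top X v)

  depth-top≤ : ∀ X v → depth (top X v) ≤ depth v
  depth-top≤ X = top-induction X (λ v t → depth t ≤ depth v) (λ _ _ → ≤-refl)
    (λ v v≢root _ ih → ≤-trans ih (depth-parent≤ v))

  ⊆⇒∉ : ∀ {X Y : Fin n → Bool} → (∀ x → X x ≡ true → Y x ≡ true) → ∀ x → Y x ≡ false → X x ≡ false
  ⊆⇒∉ {X} X⊆Y x ¬Yx with X x in Xx
  ... | false = refl
  ... | true = ⊥-elim (true≢false (X⊆Y x Xx) ¬Yx)

  top-⊆ : ∀ X Y → (∀ x → X x ≡ true → Y x ≡ true) → ∀ v → Y v ≡ false → top X v ≡ top X (top Y v)
  top-⊆ X Y X⊆Y = top-induction Y (λ v t → Y v ≡ false → top X v ≡ top X t) (λ _ _ _ → refl)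
    (λ v v≢root ¬Yp ih _ → trans (top-parent X v v≢root (⊆⇒∉ X⊆Y _ ¬Yp)) (ih ¬Yp))

  component-top : ∀ v → marked v ≡ false → ∀ {y} → y ∈ component (summary v) → y ∈ component (summary (top marked v))
  component-top = top-induction marked (λ v t → marked v ≡ false → ∀ {y} → y ∈ component (summary v) → y ∈ component (summary t))
    (λ _ _ _ y∈ → y∈) (λ v v≢root ¬mp ih ¬mv y∈ → ih ¬mp (component-parent v v≢root ¬mv ¬mp y∈))

  exits-top : ∀ v → marked v ≡ false → ∀ {y} → y ∈ exits (summary v) → y ∈ exits (summary (top marked v))
  exits-top = top-induction marked (λ v t → marked v ≡ false → ∀ {y} → y ∈ exits (summary v) → y ∈ exits (summary t))
    (λ _ _ _ y∈ → y∈) (λ v v≢root ¬mp ih ¬mv y∈ → ih ¬mp (exits-parent v v≢root ¬mv ¬mp y∈))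

  -- Two marked vertices just below the same unmarked region are both exits of its top, which has fewer than two.
  marked-exit-unique : ∀ q₁ q₂ → marked q₁ ≡ true → marked q₂ ≡ true → q₁ ≢ root → q₂ ≢ root →
                       marked (parent q₁) ≡ false → marked (parent q₂) ≡ false →
                       top marked (parent q₁) ≡ top marked (parent q₂) → q₁ ≡ q₂
  marked-exit-unique q₁ q₂ m₁ m₂ r₁ r₂ u₁ u₂ same-top with q₁ ≟ q₂
  ... | yes q₁≡q₂ = q₁≡q₂
  ... | no q₁≢q₂ = ⊥-elim (<-irrefl refl (<-≤-trans (proj₂ (proj₂ (proj₂ (unmarked-summary t (top-∉ marked (parent q₁) u₁)))))
                                              (two-distinct⇒2≤length (exits (summary t)) q₁∈ q₂∈ q₁≢q₂)))
    where
    t : Fin n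
    t = top marked (parent q₁)
    q₁∈ : q₁ ∈ exits (summary t)
    q₁∈ = exits-top (parent q₁) u₁ (marked⇒exit-of-parent q₁ r₁ m₁ u₁)
    q₂∈ : q₂ ∈ exits (summary t)
    q₂∈ = subst (λ z → q₂ ∈ exits (summary z)) (sym same-top) (exits-top (parent q₂) u₂ (marked⇒exit-of-parent q₂ r₂ m₂ u₂))

  adjacentTo : (Fin n → Bool) → Fin n → Bool
  adjacentTo X w = any (λ x → X x ∧ adj x w) (allFin n)

  adjacentTo⁺ : ∀ X {x w} → X x ≡ true → E T x w → adjacentTo X w ≡ true
  adjacentTo⁺ X {x} {w} Xx e = any-allFin⁺ (λ x → X x ∧ adj x w) x (cong₂ _∧_ Xx e)

  adjacentTo⁻ : ∀ X w → adjacentTo X w ≡ true → ∃ λ x → X x ≡ true × E T x w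
  adjacentTo⁻ X w e with any-allFin⁻ (λ x → X x ∧ adj x w) e
  ... | x , Xx∧e = x , ∧-true Xx∧e

  -- A vertex outside
  -- S₀ = W₀ ∪ Q₂ is bad if both its parent and one of its children lie in W₀ (its component would
  -- see two W₀-vertices at distance 2). Then W = W₀ ∪ N(Bad), P = Q₂ ∪ Bad gives the singletons of 𝒟''
  -- and the components of T − (W ∪ P) form 𝒟'.
  Q₁ Q₂ W₀ S₀ : Fin n → Bool
  Q₁ x = marked x ∧ not (χ x)
  Q₂ x = marked x ∧ χ x
  W₀ w = Q₁ w ∨ adjacentTo Q₂ w
  S₀ w = W₀ w ∨ Q₂ w

  hasW₀Child : Fin n → Bool
  hasW₀Child t = any (λ c → W₀ c ∧ (⌊ parent c ≟ t ⌋ ∧ not ⌊ c ≟ root ⌋)) (allFin n)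

  Bad : Fin n → Bool
  Bad t = not (S₀ t) ∧ (not ⌊ t ≟ root ⌋ ∧ (W₀ (parent t) ∧ hasW₀Child t))

  W P S : Fin n → Bool
  W w = W₀ w ∨ adjacentTo Bad w
  P w = Q₂ w ∨ Bad w
  S w = W w ∨ P w

  record BadWitness (t : Fin n) : Set where
    field
      ∉S₀      : S₀ t ≡ false
      ≢root    : t ≢ root
      parent∈W₀ : W₀ (parent t) ≡ true
      child    : Fin n
      child∈W₀ : W₀ child ≡ true
      parent-child : parent child ≡ t
      child≢root : child ≢ root

  Bad⁻ : ∀ t → Bad t ≡ true → BadWitness t
  Bad⁻ t e with ∧-true {not (S₀ t)} e
  ... | ∉ , e₁ with ∧-true {not ⌊ t ≟ root ⌋} e₁
  ... | ≢r , e₂ with ∧-true {W₀ (parent t)} e₂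
  ... | p∈ , e₃ with any-allFin⁻ (λ c → W₀ c ∧ (⌊ parent c ≟ t ⌋ ∧ not ⌊ c ≟ root ⌋)) e₃
  ... | c , e₄ with ∧-true {W₀ c} e₄
  ... | c∈ , e₅ with ∧-true {⌊ parent c ≟ t ⌋} e₅
  ... | pc≡ , c≢r = record
    { ∉S₀ = not-true ∉ ; ≢root = isYes-false (t ≟ root) (not-true ≢r) ; parent∈W₀ = p∈
    ; child = c ; child∈W₀ = c∈ ; parent-child = isYes-true (parent c ≟ t) pc≡
    ; child≢root = isYes-false (c ≟ root) (not-true c≢r) }

  Bad⁺ : ∀ {t c} → S₀ t ≡ false → t ≢ root → W₀ (parent t) ≡ true →
         W₀ c ≡ true → parent c ≡ t → c ≢ root → Bad t ≡ true
  Bad⁺ {t} {c} ∉ ≢r p∈ c∈ pc≡ c≢r =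
    cong₂ _∧_ (cong not ∉) (cong₂ _∧_ (cong not (isYes-no (t ≟ root) ≢r)) (cong₂ _∧_ p∈
      (any-allFin⁺ (λ c → W₀ c ∧ (⌊ parent c ≟ t ⌋ ∧ not ⌊ c ≟ root ⌋)) c
        (cong₂ _∧_ c∈ (cong₂ _∧_ (isYes-yes (parent c ≟ t) pc≡) (cong not (isYes-no (c ≟ root) c≢r)))))))

  colour-V₂⇒V₁ : ∀ {x w} → E T x w → χ x ≡ true → χ w ≡ false
  colour-V₂⇒V₁ e χx rewrite colour-edge e | χx = refl

  colour-V₁⇒V₂ : ∀ {x w} → E T x w → χ x ≡ false → χ w ≡ true
  colour-V₁⇒V₂ e χx rewrite colour-edge e | χx = refl

  W₀⊆V₁ : ∀ w → W₀ w ≡ true → χ w ≡ false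
  W₀⊆V₁ w e with ∨-true {Q₁ w} e
  ... | inj₁ q₁ = not-true (proj₂ (∧-true {marked w} q₁))
  ... | inj₂ adj₂ with adjacentTo⁻ Q₂ w adj₂
  ... | x , q₂ , e′ = colour-V₂⇒V₁ e′ (proj₂ (∧-true {marked x} q₂))

  Bad⊆V₂ : ∀ t → Bad t ≡ true → χ t ≡ true
  Bad⊆V₂ t e = let open BadWitness (Bad⁻ t e) in
    colour-V₁⇒V₂ (E-sym T (parent-edge t ≢root)) (W₀⊆V₁ (parent t) parent∈W₀)

  W⊆V₁ : ∀ w → W w ≡ true → χ w ≡ false
  W⊆V₁ w e with ∨-true {W₀ w} e
  ... | inj₁ w₀ = W₀⊆V₁ w w₀
  ... | inj₂ adj-bad with adjacentTo⁻ Bad w adj-bad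
  ... | x , bad , e′ = colour-V₂⇒V₁ e′ (Bad⊆V₂ x bad)

  P⊆V₂ : ∀ p → P p ≡ true → χ p ≡ true
  P⊆V₂ p e with ∨-true {Q₂ p} e
  ... | inj₁ q₂ = proj₂ (∧-true {marked p} q₂)
  ... | inj₂ bad = Bad⊆V₂ p bad

  W⇒∉P : ∀ w → W w ≡ true → P w ≡ false
  W⇒∉P w e with P w in e′
  ... | false = refl
  ... | true = ⊥-elim (true≢false (P⊆V₂ w e′) (W⊆V₁ w e))

  P-neighbour∈W : ∀ p u → P p ≡ true → E T p u → W u ≡ true
  P-neighbour∈W p u e pu with ∨-true {Q₂ p} e
  ... | inj₁ q₂ = ∨-trueˡ (adjacentTo Bad u) (∨-trueʳ (Q₁ u) (adjacentTo⁺ Q₂ q₂ pu))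
  ... | inj₂ bad = ∨-trueʳ (W₀ u) (adjacentTo⁺ Bad bad pu)

  marked⊆S₀ : ∀ x → marked x ≡ true → S₀ x ≡ true
  marked⊆S₀ x e = by-colour (χ x) refl
    where
    by-colour : ∀ b → χ x ≡ b → S₀ x ≡ true
    by-colour true χx = ∨-trueʳ (W₀ x) (cong₂ _∧_ e χx)
    by-colour false χx = ∨-trueˡ (Q₂ x) (∨-trueˡ (adjacentTo Q₂ x) (cong₂ _∧_ e (cong not χx)))

  W₀⊆S₀ : ∀ x → W₀ x ≡ true → S₀ x ≡ true
  W₀⊆S₀ x = ∨-trueˡ (Q₂ x)

  S₀⊆S : ∀ x → S₀ x ≡ true → S x ≡ true
  S₀⊆S x e with ∨-true {W₀ x} e
  ... | inj₁ w₀ = ∨-trueˡ (P x) (∨-trueˡ (adjacentTo Bad x) w₀)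
  ... | inj₂ q₂ = ∨-trueʳ (W x) (∨-trueˡ (Bad x) q₂)

  marked⊆S : ∀ x → marked x ≡ true → S x ≡ true
  marked⊆S x e = S₀⊆S x (marked⊆S₀ x e)

  Bad⊆S : ∀ x → Bad x ≡ true → S x ≡ true
  Bad⊆S x e = ∨-trueʳ (W x) (∨-trueʳ (Q₂ x) e)

  W⊆S : ∀ x → W x ≡ true → S x ≡ true
  W⊆S x = ∨-trueˡ (P x)

  W₀-representative : ∀ w → W₀ w ≡ true → w ≢ root → S₀ (parent w) ≡ false →
    ∃ λ q → marked q ≡ true × q ≢ root × marked (parent q) ≡ false ×
            top marked (parent q) ≡ top marked (parent w) × (q ≡ w ⊎ parent q ≡ w)
  W₀-representative w e w≢root ∉S₀ with Q₁ w in q₁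
  ... | true = w , proj₁ (∧-true {marked w} q₁) , w≢root , ⊆⇒∉ marked⊆S₀ (parent w) ∉S₀ , refl , inj₁ refl
  ... | false with adjacentTo⁻ Q₂ w e
  ... | x , q₂ , xw with edge-parent xw
  ... | inj₁ (_ , pw≡x) = ⊥-elim (true≢false (∨-trueʳ (W₀ x) q₂) (subst (λ z → S₀ z ≡ false) pw≡x ∉S₀))
  ... | inj₂ (x≢root , px≡w) = x , proj₁ (∧-true {marked x} q₂) , x≢root , subst (λ z → marked z ≡ false) (sym px≡w) w-unmarked ,
                                 trans (cong (top marked) px≡w) (top-parent marked w w≢root (⊆⇒∉ marked⊆S₀ (parent w) ∉S₀)) ,
                                 inj₂ px≡w
    where
    w-unmarked : marked w ≡ false
    w-unmarked = ≢true⇒false λ m → true≢false (cong₂ _∧_ m (cong not (colour-V₂⇒V₁ xw (proj₂ (∧-true {marked x} q₂))))) q₁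

  W₀-exit-unique : ∀ w₁ w₂ → W₀ w₁ ≡ true → W₀ w₂ ≡ true → w₁ ≢ root → w₂ ≢ root →
                   S₀ (parent w₁) ≡ false → S₀ (parent w₂) ≡ false →
                   top S₀ (parent w₁) ≡ top S₀ (parent w₂) → w₁ ≡ w₂
  W₀-exit-unique w₁ w₂ e₁ e₂ r₁ r₂ p₁ p₂ same-top
    with W₀-representative w₁ e₁ r₁ p₁ | W₀-representative w₂ e₂ r₂ p₂
  ... | q₁ , m₁ , n₁ , u₁ , t₁ , c₁ | q₂ , m₂ , n₂ , u₂ , t₂ , c₂ = same c₁ c₂
    where
    same-marked-top : top marked (parent w₁) ≡ top marked (parent w₂)
    same-marked-top = trans (top-⊆ marked S₀ marked⊆S₀ (parent w₁) p₁)
      (trans (cong (top marked) same-top) (sym (top-⊆ marked S₀ marked⊆S₀ (parent w₂) p₂)))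
    q₁≡q₂ : q₁ ≡ q₂
    q₁≡q₂ = marked-exit-unique q₁ q₂ m₁ m₂ n₁ n₂ u₁ u₂ (trans t₁ (trans same-marked-top (sym t₂)))
    -- the mixed cases would put a W₀-vertex (and so an S₀-vertex) at the parent of the other one
    same : q₁ ≡ w₁ ⊎ parent q₁ ≡ w₁ → q₂ ≡ w₂ ⊎ parent q₂ ≡ w₂ → w₁ ≡ w₂
    same (inj₁ a) (inj₁ b) = trans (sym a) (trans q₁≡q₂ b)
    same (inj₂ a) (inj₂ b) = trans (sym a) (trans (cong parent q₁≡q₂) b)
    same (inj₁ a) (inj₂ b) = ⊥-elim (true≢false (W₀⊆S₀ w₂ e₂)
      (subst (λ z → S₀ z ≡ false) (trans (cong parent (trans (sym a) q₁≡q₂)) b) p₁))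
    same (inj₂ a) (inj₁ b) = ⊥-elim (true≢false (W₀⊆S₀ w₁ e₁)
      (subst (λ z → S₀ z ≡ false) (trans (cong parent (trans (sym b) (sym q₁≡q₂))) a) p₂))

  exit∈W₀ : ∀ w → W w ≡ true → w ≢ root → S (parent w) ≡ false → W₀ w ≡ true
  exit∈W₀ w e w≢root ∉S with ∨-true {W₀ w} e
  ... | inj₁ w₀ = w₀
  ... | inj₂ adj-bad with adjacentTo⁻ Bad w adj-bad
  ... | x , bad , xw with edge-parent xw
  ... | inj₁ (_ , pw≡x) = ⊥-elim (true≢false (Bad⊆S x bad) (subst (λ z → S z ≡ false) pw≡x ∉S))
  ... | inj₂ (_ , px≡w) = subst (λ z → W₀ z ≡ true) px≡w (BadWitness.parent∈W₀ (Bad⁻ x bad))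

  S₀⊆S-∉ : ∀ x → S x ≡ false → S₀ x ≡ false
  S₀⊆S-∉ = ⊆⇒∉ S₀⊆S

  W-exit-unique : ∀ w₁ w₂ → W w₁ ≡ true → W w₂ ≡ true → w₁ ≢ root → w₂ ≢ root →
                  S (parent w₁) ≡ false → S (parent w₂) ≡ false →
                  top S (parent w₁) ≡ top S (parent w₂) → w₁ ≡ w₂
  W-exit-unique w₁ w₂ e₁ e₂ r₁ r₂ p₁ p₂ same-top =
    W₀-exit-unique w₁ w₂ (exit∈W₀ w₁ e₁ r₁ p₁) (exit∈W₀ w₂ e₂ r₂ p₂) r₁ r₂ (S₀⊆S-∉ _ p₁) (S₀⊆S-∉ _ p₂)
      (trans (top-⊆ S₀ S S₀⊆S (parent w₁) p₁) (trans (cong (top S₀) same-top) (sym (top-⊆ S₀ S S₀⊆S (parent w₂) p₂))))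

  private
    ∉S₀-parent : ∀ t → W (parent t) ≡ true → W₀ (parent t) ≡ false → S₀ (parent t) ≡ false
    ∉S₀-parent t wp ¬w₀ = ≢true⇒false λ s₀ → case (∨-true {W₀ (parent t)} s₀)
      where
      case : W₀ (parent t) ≡ true ⊎ Q₂ (parent t) ≡ true → Empty
      case (inj₁ w₀) = true≢false w₀ ¬w₀
      case (inj₂ q₂) = true≢false (proj₂ (∧-true {marked (parent t)} q₂)) (W⊆V₁ (parent t) wp)

    -- b and the W₀-child of x would be two W₀-exits of the same S₀-region, so b would be a child of x.
    ¬W₀-grandchild-of-bad : ∀ t b x → S₀ t ≡ false → t ≢ root → S₀ (parent t) ≡ false → parent t ≢ root →
                            parent (parent t) ≡ x → Bad x ≡ true → W₀ b ≡ true → b ≢ root → parent b ≡ t → Empty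
    ¬W₀-grandchild-of-bad t b x ∉S₀t t≢root ∉S₀pt pt≢root ppt≡x bad w₀b b≢root pb≡t =
      <-irrefl (cong depth (sym t≡x)) deeper
      where
      open BadWitness (Bad⁻ x bad) using (∉S₀; child; child∈W₀; parent-child; child≢root)
      same-S₀-top : top S₀ (parent b) ≡ top S₀ (parent child)
      same-S₀-top = begin
        top S₀ (parent b)          ≡⟨ cong (top S₀) pb≡t ⟩
        top S₀ t                   ≡⟨ top-parent S₀ t t≢root ∉S₀pt ⟩
        top S₀ (parent t)          ≡⟨ top-parent S₀ (parent t) pt≢root (subst (λ z → S₀ z ≡ false) (sym ppt≡x) ∉S₀) ⟩
        top S₀ (parent (parent t)) ≡⟨ cong (top S₀) (trans ppt≡x (sym parent-child)) ⟩
        top S₀ (parent child)      ∎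
        where open ≡-Reasoning
      b≡child : b ≡ child
      b≡child = W₀-exit-unique b child w₀b child∈W₀ b≢root child≢root (subst (λ z → S₀ z ≡ false) (sym pb≡t) ∉S₀t)
        (subst (λ z → S₀ z ≡ false) (sym parent-child) ∉S₀) same-S₀-top
      t≡x : t ≡ x
      t≡x = trans (sym pb≡t) (trans (cong parent b≡child) parent-child)
      deeper : depth x < depth t
      deeper = subst (λ z → depth z < depth t) ppt≡x (≤-<-trans (depth-parent≤ (parent t)) (depth-parent< t t≢root))

  ∉S⇒¬W-parent-and-child : ∀ t b → S t ≡ false → t ≢ root → W (parent t) ≡ true →
                            W b ≡ true → b ≢ root → parent b ≡ t → Empty
  ∉S⇒¬W-parent-and-child t b ∉S t≢root wp wb b≢root pb≡t with W₀ (parent t) Bool.≟ true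
  ... | yes w₀p = true≢false (Bad⊆S t (Bad⁺ (S₀⊆S-∉ t ∉S) t≢root w₀p w₀b pb≡t b≢root)) ∉S
    where
    w₀b : W₀ b ≡ true
    w₀b = exit∈W₀ b wb b≢root (subst (λ z → S z ≡ false) (sym pb≡t) ∉S)
  ... | no ¬w₀p with adjacentTo⁻ Bad (parent t) (bad-neighbour (∨-true {W₀ (parent t)} wp))
    where
    bad-neighbour : W₀ (parent t) ≡ true ⊎ adjacentTo Bad (parent t) ≡ true → adjacentTo Bad (parent t) ≡ true
    bad-neighbour (inj₁ w₀) = ⊥-elim (¬w₀p w₀)
    bad-neighbour (inj₂ a) = a
  ... | x , bad , x-pt with edge-parent x-pt
  ... | inj₂ (_ , px≡pt) = ¬w₀p (subst (λ z → W₀ z ≡ true) px≡pt (BadWitness.parent∈W₀ (Bad⁻ x bad)))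
  ... | inj₁ (pt≢root , ppt≡x) =
    ¬W₀-grandchild-of-bad t b x (S₀⊆S-∉ t ∉S) t≢root (∉S₀-parent t wp (≢true⇒false ¬w₀p)) pt≢root ppt≡x bad
      (exit∈W₀ b wb b≢root (subst (λ z → S z ≡ false) (sym pb≡t) ∉S)) b≢root pb≡t

  opaque
    inBlock : Fin n → Fin n → Bool
    inBlock t x = not (S x) ∧ ⌊ top S x ≟ t ⌋

    inBlock⁻ : ∀ t x → inBlock t x ≡ true → S x ≡ false × top S x ≡ t
    inBlock⁻ t x e with ∧-true {not (S x)} e
    ... | ∉S , top≡ = not-true ∉S , isYes-true (top S x ≟ t) top≡

    inBlock⁺ : ∀ t x → S x ≡ false → top S x ≡ t → inBlock t x ≡ true
    inBlock⁺ t x ∉S top≡ = cong₂ _∧_ (cong not ∉S) (isYes-yes (top S x ≟ t) top≡)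

    S⇒¬inBlock : ∀ t x → S x ≡ true → inBlock t x ≡ false
    S⇒¬inBlock t x ∈S rewrite ∈S = refl

  block : Fin n → Subset n
  block t = tabulate (inBlock t)

  ∈-block⁻ : ∀ t x → x Subset.∈ block t → S x ≡ false × top S x ≡ t
  ∈-block⁻ t x x∈ = inBlock⁻ t x (∈-tabulate⁻ (inBlock t) x x∈)

  ∈-block⁺ : ∀ t x → S x ≡ false → top S x ≡ t → x Subset.∈ block t
  ∈-block⁺ t x ∉S top≡ = ∈-tabulate⁺ (inBlock t) x (inBlock⁺ t x ∉S top≡)

  BlockEdge : Fin n → Fin n → Fin n → Set
  BlockEdge t x y = E T x y × x Subset.∈ block t × y Subset.∈ block t

  walk-to-top : ∀ v → S v ≡ false → ∃ λ m → Walk T (BlockEdge (top S v)) v (top S v) m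
  walk-to-top = top-induction S (λ v t → S v ≡ false → ∃ λ m → Walk T (BlockEdge t) v t m)
    (λ _ _ _ → 0 , here)
    λ v v≢root ∉Sp ih ∉S → let (m , p) = ih ∉Sp in
      suc m , step (parent-edge v v≢root , ∈-block⁺ _ v ∉S (top-parent S v v≢root ∉Sp) , ∈-block⁺ _ (parent v) ∉Sp refl) p

  block-subtree : ∀ t → inBlock t t ≡ true → IsSubtree T (block t)
  block-subtree t t∈ = (t , ∈-tabulate⁺ (inBlock t) t t∈) , walks
    where
    via-top : ∀ u → u Subset.∈ block t → ∃ λ m → Walk T (BlockEdge t) u t m
    via-top u u∈ with ∈-block⁻ t u u∈
    ... | ∉S , refl = walk-to-top u ∉S
    walks : ∀ u v → u Subset.∈ block t → v Subset.∈ block t → ∃ λ m → Walk T (BlockEdge t) u v m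
    walks u v u∈ v∈ with via-top u u∈ | via-top v v∈
    ... | m₁ , p₁ | m₂ , p₂ = m₁ + m₂ , walk-++ T p₁ (walk-reverse T (λ _ _ (e , x∈ , y∈) → E-sym T e , y∈ , x∈) p₂)

  ⁅⁆-subtree : ∀ p → IsSubtree T ⁅ p ⁆
  ⁅⁆-subtree p = (p , Subsetₚ.x∈⁅x⁆ p) , walks
    where
    walks : ∀ u v → u Subset.∈ ⁅ p ⁆ → v Subset.∈ ⁅ p ⁆ →
            ∃ λ m → Walk T (λ x y → E T x y × x Subset.∈ ⁅ p ⁆ × y Subset.∈ ⁅ p ⁆) u v m
    walks u v u∈ v∈ with Subsetₚ.x∈⁅y⁆⇒x≡y p u∈ | Subsetₚ.x∈⁅y⁆⇒x≡y p v∈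
    ... | refl | refl = 0 , here

  depth-block : ∀ t x → x Subset.∈ block t → depth t ≤ depth x
  depth-block t x x∈ with ∈-block⁻ t x x∈
  ... | _ , refl = depth-top≤ S x

  Wset : Subset n
  Wset = tabulate W

  ∈-Nbhd⁻ : ∀ (X : Subset n) w → w Subset.∈ Nbhd T X → ∃ λ u → u Subset.∈ X × E T u w
  ∈-Nbhd⁻ X w w∈ with any-allFin⁻ (λ u → lookup X u ∧ adj u w)
                        (∈-tabulate⁻ (λ w → any (λ u → lookup X u ∧ adj u w) (allFin n)) w w∈)
  ... | u , e with ∧-true {lookup X u} e
  ... | u∈ , uw = u , lookup⇒∈ X u u∈ , uw

  IsExit : Fin n → Fin n → Set
  IsExit t w = W w ≡ true × w ≢ root × S (parent w) ≡ false × top S (parent w) ≡ t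

  IsExit? : ∀ t w → Dec (IsExit t w)
  IsExit? t w = (W w Bool.≟ true) ×-dec ¬? (w ≟ root) ×-dec (S (parent w) Bool.≟ false) ×-dec (top S (parent w) ≟ t)

  exit-unique : ∀ {t w₁ w₂} → IsExit t w₁ → IsExit t w₂ → w₁ ≡ w₂
  exit-unique (e₁ , r₁ , s₁ , t₁) (e₂ , r₂ , s₂ , t₂) = W-exit-unique _ _ e₁ e₂ r₁ r₂ s₁ s₂ (trans t₁ (sym t₂))

  block-neighbour : ∀ t w → w Subset.∈ Wset ∩ Nbhd T (block t) → (w ≡ parent t × t ≢ root) ⊎ IsExit t w
  block-neighbour t w w∈ with Subsetₚ.x∈p∩q⁻ Wset (Nbhd T (block t)) w∈
  ... | w∈W , w∈N with ∈-Nbhd⁻ (block t) w w∈N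
  ... | u , u∈ , uw with ∈-block⁻ t u u∈ | ∈-tabulate⁻ W w w∈W
  ... | ∉S , top≡ | Ww with edge-parent uw
  ... | inj₁ (w≢root , pw≡u) = inj₂ (Ww , w≢root , subst (λ z → S z ≡ false) (sym pw≡u) ∉S , trans (cong (top S) pw≡u) top≡)
  ... | inj₂ (u≢root , pu≡w) = inj₁ (trans (sym pu≡w) (cong parent u≡t) , subst (_≢ root) u≡t u≢root)
    where
    u≡t : u ≡ t
    u≡t = trans (sym (top-AtTop S u (inj₂ (subst (λ z → S z ≡ true) (sym pu≡w) (W⊆S w Ww))))) top≡

  parent-exit-far : ∀ t b → inBlock t t ≡ true → t ≢ root → W (parent t) ≡ true → IsExit t b → parent t ≢ b →
                    DistAtLeast T 4 (parent t) b
  parent-exit-far t b t∈ t≢root wp (wb , b≢root , ∉Spb , top≡) pt≢b = go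
    where
    ∉St : S t ≡ false
    ∉St = proj₁ (inBlock⁻ t t t∈)
    pb∈ : parent b Subset.∈ block t
    pb∈ = ∈-block⁺ t (parent b) ∉Spb top≡
    -- both ends lie in V₁, so every walk between them has even length
    even : ∀ {m} → Walk T (E T) (parent t) b m → odd m ≡ false
    even {m} p = trans (sym (trans (colour-walk p) (cong (_xor odd m) (W⊆V₁ (parent t) wp)))) (W⊆V₁ b wb)
    shallower : ∀ x → depth x < depth t → x ≢ parent b
    shallower x x<t refl = <-irrefl refl (<-≤-trans x<t (depth-block t (parent b) pb∈))
    dpt<dt : depth (parent t) < depth t
    dpt<dt = depth-parent< t t≢root
    go : ∀ m → Walk T (E T) (parent t) b m → 4 ≤ m
    go zero here = ⊥-elim (pt≢b refl)
    go 1 p with even p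
    ... | ()
    go 3 p with even p
    ... | ()
    go (suc (suc (suc (suc m)))) _ = s≤s (s≤s (s≤s (s≤s z≤n)))
    go 2 (step {v = c} e₁ (step e₂ here)) with edge-parent (E-sym T e₁) | edge-parent e₂
    ... | inj₂ (c≢root , pc≡pt) | inj₁ (_ , pb≡c) = ⊥-elim (∉S⇒¬W-parent-and-child t b ∉St t≢root wp wb b≢root (trans pb≡c c≡t))
      where
      c≡t : c ≡ t
      c≡t = trans (sym (top-AtTop S c (inj₂ (subst (λ z → S z ≡ true) (sym pc≡pt) (W⊆S _ wp)))))
                  (trans (cong (top S) (sym pb≡c)) top≡)
    ... | inj₂ (_ , pc≡pt) | inj₂ (_ , pc≡b) = ⊥-elim (pt≢b (trans (sym pc≡pt) pc≡b))
    ... | inj₁ (_ , ppt≡c) | inj₁ (_ , pb≡c) =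
      ⊥-elim (shallower (parent (parent t)) (≤-<-trans (depth-parent≤ (parent t)) dpt<dt) (trans ppt≡c (sym pb≡c)))
    ... | inj₁ (_ , ppt≡c) | inj₂ (_ , pc≡b) =
      ⊥-elim (shallower (parent b) (≤-<-trans (depth-parent≤ b) (subst (λ z → depth z < depth t) (trans (cong parent ppt≡c) pc≡b)
        (≤-<-trans (depth-parent≤ (parent (parent t))) (≤-<-trans (depth-parent≤ (parent t)) dpt<dt)))) refl)

  block-few-neighbours : ∀ t → ∣ Wset ∩ Nbhd T (block t) ∣ ≤ 2
  block-few-neighbours t with Finₚ.any? (IsExit? t)
  ... | yes (b , exit) = begin
    ∣ Wset ∩ Nbhd T (block t) ∣     ≤⟨ Subsetₚ.p⊆q⇒∣p∣≤∣q∣ ⊆pair ⟩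
    ∣ ⁅ parent t ⁆ ∪ ⁅ b ⁆ ∣        ≤⟨ ∣p∪q∣≤∣p∣+∣q∣ ⁅ parent t ⁆ ⁅ b ⁆ ⟩
    ∣ ⁅ parent t ⁆ ∣ + ∣ ⁅ b ⁆ ∣    ≡⟨ cong₂ _+_ (Subsetₚ.∣⁅x⁆∣≡1 (parent t)) (Subsetₚ.∣⁅x⁆∣≡1 b) ⟩
    2                               ∎
    where
    open ≤-Reasoning
    ⊆pair : ∀ {w} → w Subset.∈ Wset ∩ Nbhd T (block t) → w Subset.∈ ⁅ parent t ⁆ ∪ ⁅ b ⁆
    ⊆pair {w} w∈ with block-neighbour t w w∈
    ... | inj₁ (refl , _) = Subsetₚ.x∈p∪q⁺ (inj₁ (Subsetₚ.x∈⁅x⁆ _))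
    ... | inj₂ exit′ rewrite exit-unique exit′ exit = Subsetₚ.x∈p∪q⁺ (inj₂ (Subsetₚ.x∈⁅x⁆ b))
  ... | no no-exit = ≤-trans (Subsetₚ.p⊆q⇒∣p∣≤∣q∣ ⊆parent) (≤-trans (≤-reflexive (Subsetₚ.∣⁅x⁆∣≡1 (parent t))) (s≤s z≤n))
    where
    ⊆parent : ∀ {w} → w Subset.∈ Wset ∩ Nbhd T (block t) → w Subset.∈ ⁅ parent t ⁆
    ⊆parent {w} w∈ with block-neighbour t w w∈
    ... | inj₁ (refl , _) = Subsetₚ.x∈⁅x⁆ _
    ... | inj₂ exit = ⊥-elim (no-exit (w , exit))

  block-neighbours-far : ∀ t → inBlock t t ≡ true → ∀ z₁ z₂ →
    z₁ Subset.∈ Wset ∩ Nbhd T (block t) → z₂ Subset.∈ Wset ∩ Nbhd T (block t) → z₁ ≢ z₂ → DistAtLeast T 4 z₁ z₂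
  block-neighbours-far t t∈ z₁ z₂ z₁∈ z₂∈ z₁≢z₂ with block-neighbour t z₁ z₁∈ | block-neighbour t z₂ z₂∈
  ... | inj₁ (e₁ , _) | inj₁ (e₂ , _) = ⊥-elim (z₁≢z₂ (trans e₁ (sym e₂)))
  ... | inj₂ x₁ | inj₂ x₂ = ⊥-elim (z₁≢z₂ (exit-unique x₁ x₂))
  ... | inj₁ (refl , t≢root) | inj₂ x₂ =
    parent-exit-far t z₂ t∈ t≢root (∈-tabulate⁻ W _ (proj₁ (Subsetₚ.x∈p∩q⁻ Wset _ z₁∈))) x₂ z₁≢z₂
  ... | inj₂ x₁ | inj₁ (refl , t≢root) = λ m p →
    parent-exit-far t z₁ t∈ t≢root (∈-tabulate⁻ W _ (proj₁ (Subsetₚ.x∈p∩q⁻ Wset _ z₂∈))) x₁ (≢-sym z₁≢z₂) m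
      (walk-reverse T (λ _ _ → E-sym T) p)

  block-small : ∀ t → inBlock t t ≡ true → ∣ block t ∣ < ℓ
  block-small t t∈ = begin-strict
    ∣ block t ∣                          ≤⟨ Subsetₚ.p⊆q⇒∣p∣≤∣q∣ ⊆component ⟩
    ∣ ⋃ (component (summary t₀)) ⁅_⁆ ∣   ≤⟨ ∣⋃∣≤ (component (summary t₀)) ⁅_⁆ 1 (λ a → ≤-reflexive (Subsetₚ.∣⁅x⁆∣≡1 a)) ⟩
    length (component (summary t₀)) * 1  ≡⟨ *-identityʳ _ ⟩
    length (component (summary t₀))      <⟨ proj₁ (proj₂ (proj₂ (unmarked-summary t₀ t₀-unmarked))) ⟩
    ℓ                                    ∎
    where
    open ≤-Reasoning
    t₀ : Fin n
    t₀ = top marked t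
    t₀-unmarked : marked t₀ ≡ false
    t₀-unmarked = top-∉ marked t (⊆⇒∉ marked⊆S t (proj₁ (inBlock⁻ t t t∈)))
    ⊆component : ∀ {x} → x Subset.∈ block t → x Subset.∈ ⋃ (component (summary t₀)) ⁅_⁆
    ⊆component {x} x∈ with ∈-block⁻ t x x∈
    ... | ∉S , refl = ∈-⋃⁺ (component (summary t₀)) ⁅_⁆ x∈component (Subsetₚ.x∈⁅x⁆ x)
      where
      x-unmarked : marked x ≡ false
      x-unmarked = ⊆⇒∉ marked⊆S x ∉S
      x∈component : x ∈ component (summary t₀)
      x∈component = subst (λ z → x ∈ component (summary z)) (top-⊆ marked S marked⊆S x ∉S)
                      (component-top x x-unmarked (unmarked⇒∈component x x-unmarked))

  blockTops Pvertices : List (Fin n)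
  blockTops = filter (λ t → inBlock t t Bool.≟ true) (allFin n)
  Pvertices = filter (λ p → P p Bool.≟ true) (allFin n)

  ∈-blockTops⁻ : ∀ {t} → t ∈ blockTops → inBlock t t ≡ true
  ∈-blockTops⁻ t∈ = proj₂ (∈-filter⁻ (λ t → inBlock t t Bool.≟ true) {xs = allFin n} t∈)

  ∈-blockTops⁺ : ∀ {t} → inBlock t t ≡ true → t ∈ blockTops
  ∈-blockTops⁺ {t} = ∈-filter⁺ (λ t → inBlock t t Bool.≟ true) (∈-allFin t)

  ∈-Pvertices⁻ : ∀ {p} → p ∈ Pvertices → P p ≡ true
  ∈-Pvertices⁻ p∈ = proj₂ (∈-filter⁻ (λ p → P p Bool.≟ true) {xs = allFin n} p∈)

  ∈-Pvertices⁺ : ∀ {p} → P p ≡ true → p ∈ Pvertices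
  ∈-Pvertices⁺ {p} = ∈-filter⁺ (λ p → P p Bool.≟ true) (∈-allFin p)

  blockTops-Unique : Unique blockTops
  blockTops-Unique = Uniqueₚ.filter⁺ (λ t → inBlock t t Bool.≟ true) (Uniqueₚ.allFin⁺ n)

  Pvertices-Unique : Unique Pvertices
  Pvertices-Unique = Uniqueₚ.filter⁺ (λ p → P p Bool.≟ true) (Uniqueₚ.allFin⁺ n)

  𝒟′ 𝒟″ : List (Subset n)
  𝒟′ = map block blockTops
  𝒟″ = map ⁅_⁆ Pvertices

  ∈-𝒟⁻ : ∀ K → K ∈ 𝒟′ ++ 𝒟″ → (∃ λ t → t ∈ blockTops × K ≡ block t) ⊎ (∃ λ p → p ∈ Pvertices × K ≡ ⁅ p ⁆)
  ∈-𝒟⁻ K K∈ with ∈-++⁻ 𝒟′ K∈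
  ... | inj₁ K∈′ = inj₁ (∈-map⁻ block K∈′)
  ... | inj₂ K∈″ = inj₂ (∈-map⁻ ⁅_⁆ K∈″)

  -- A vertex outside S = W ∪ P lies exactly in the block of its top.
  partition : ∀ v → (if lookup Wset v then 1 else 0) + occ T v (𝒟′ ++ 𝒟″) ≡ 1
  partition v rewrite count-++ (λ K → lookup K v) 𝒟′ 𝒟″ | count-map (λ K → lookup K v) block blockTops
                    | count-map (λ K → lookup K v) ⁅_⁆ Pvertices | Vecₚ.lookup∘tabulate W v =
    by-cases (W v) refl (P v) refl
    where
    lookup-block : ∀ t → lookup (block t) v ≡ inBlock t v
    lookup-block t = Vecₚ.lookup∘tabulate (inBlock t) v
    lookup-⁅⁆ : ∀ p → lookup ⁅ p ⁆ v ≡ true → v ≡ p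
    lookup-⁅⁆ p e = Subsetₚ.x∈⁅y⁆⇒x≡y p (lookup⇒∈ ⁅ p ⁆ v e)
    no-block : S v ≡ true → count (λ t → lookup (block t) v) blockTops ≡ 0
    no-block ∈S = count≡0 _ blockTops λ t _ → trans (lookup-block t) (S⇒¬inBlock t v ∈S)
    no-singleton : P v ≡ false → count (λ p → lookup ⁅ p ⁆ v) Pvertices ≡ 0
    no-singleton ∉P = count≡0 _ Pvertices λ p p∈ →
      ≢true⇒false λ e → true≢false (subst (λ z → P z ≡ true) (sym (lookup-⁅⁆ p e)) (∈-Pvertices⁻ p∈)) ∉P
    by-cases : ∀ a → W v ≡ a → ∀ b → P v ≡ b →
               (if a then 1 else 0) + (count (λ t → lookup (block t) v) blockTops + count (λ p → lookup ⁅ p ⁆ v) Pvertices) ≡ 1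
    by-cases true ∈W _ _ rewrite no-block (W⊆S v ∈W) | no-singleton (W⇒∉P v ∈W) = refl
    by-cases false _ true ∈P rewrite no-block (∨-trueʳ (W v) ∈P) =
      count≡1 _ Pvertices Pvertices-Unique (∈-Pvertices⁺ ∈P) (Vecₚ.[]=⇒lookup (Subsetₚ.x∈⁅x⁆ v))
        λ p _ e → sym (lookup-⁅⁆ p e)
    by-cases false ∉W false ∉P rewrite no-singleton ∉P =
      trans (+-identityʳ _) (count≡1 _ blockTops blockTops-Unique (∈-blockTops⁺ t∈) (trans (lookup-block t) (inBlock⁺ t v ∉S refl))
        λ t′ _ e → sym (proj₂ (inBlock⁻ t′ v (trans (sym (lookup-block t′)) e))))
      where
      ∉S : S v ≡ false
      ∉S = cong₂ _∨_ ∉W ∉P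
      t : Fin n
      t = top S v
      t∈ : inBlock t t ≡ true
      t∈ = inBlock⁺ t t (top-∉ S v ∉S) (top-idem S v)

  Δ : ℕ
  Δ = maxDegTrue T χ

  deg≤Δ : ∀ p → χ p ≡ true → deg T p ≤ Δ
  deg≤Δ p χp = subst (_≤ Δ) (cong (λ b → if b then deg T p else 0) χp)
    (∈⇒≤foldr⊔ _ (∈-map⁺ (λ v → if χ v then deg T v else 0) (∈-allFin p)))

  V₂-neighbours : Fin n → Subset n
  V₂-neighbours x = if χ x then tabulate (adj x) else ⊥

  ∣V₂-neighbours∣≤Δ : ∀ x → ∣ V₂-neighbours x ∣ ≤ Δ
  ∣V₂-neighbours∣≤Δ x = by-colour (χ x) refl
    where
    by-colour : ∀ b → χ x ≡ b → ∣ V₂-neighbours x ∣ ≤ Δ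
    by-colour true χx rewrite χx = deg≤Δ x χx
    by-colour false χx rewrite χx = ≤-trans (≤-reflexive (Subsetₚ.∣⊥∣≡0 n)) z≤n

  ∈-V₂-neighbours : ∀ x w → χ x ≡ true → E T x w → w Subset.∈ V₂-neighbours x
  ∈-V₂-neighbours x w χx xw =
    subst (λ b → w Subset.∈ (if b then tabulate (adj x) else ⊥)) (sym χx) (∈-tabulate⁺ (adj x) w xw)

  cuts-root : List (Fin n)
  cuts-root = cuts (summary root)

  -- Every vertex of W is charged to a marked vertex q: it is q, or a neighbour of a V₂-vertex among q, its parent and grandparent.
  W-cover : Fin n → Subset n
  W-cover q = ⁅ q ⁆ ∪ (V₂-neighbours q ∪ (V₂-neighbours (parent q) ∪ V₂-neighbours (parent (parent q))))

  ∣W-cover∣≤ : ∀ q → ∣ W-cover q ∣ ≤ 1 + (Δ + (Δ + Δ))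
  ∣W-cover∣≤ q = ≤-trans (∣p∪q∣≤∣p∣+∣q∣ ⁅ q ⁆ _) (+-mono-≤ (≤-reflexive (Subsetₚ.∣⁅x⁆∣≡1 q))
    (≤-trans (∣p∪q∣≤∣p∣+∣q∣ (V₂-neighbours q) _) (+-mono-≤ (∣V₂-neighbours∣≤Δ q)
      (≤-trans (∣p∪q∣≤∣p∣+∣q∣ (V₂-neighbours (parent q)) _)
        (+-mono-≤ (∣V₂-neighbours∣≤Δ (parent q)) (∣V₂-neighbours∣≤Δ (parent (parent q))))))))

  Bad-near-marked : ∀ x → Bad x ≡ true → ∃ λ q → q ∈ cuts-root × (parent q ≡ x ⊎ parent (parent q) ≡ x)
  Bad-near-marked x bad with Bad⁻ x bad
  ... | witness with ∨-true {Q₁ (BadWitness.child witness)} (BadWitness.child∈W₀ witness)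
  ... | inj₁ q₁ = BadWitness.child witness , marked⇒∈cuts-root _ (proj₁ (∧-true {marked (BadWitness.child witness)} q₁)) ,
                  inj₁ (BadWitness.parent-child witness)
  ... | inj₂ adj₂ with adjacentTo⁻ Q₂ (BadWitness.child witness) adj₂
  ... | y , q₂ , yc with edge-parent yc
  ... | inj₁ (_ , pc≡y) = ⊥-elim (true≢false (∨-trueʳ (W₀ x) (subst (λ z → Q₂ z ≡ true) (trans (sym pc≡y) (BadWitness.parent-child witness)) q₂))
                                             (BadWitness.∉S₀ witness))
  ... | inj₂ (_ , py≡c) = y , marked⇒∈cuts-root y (proj₁ (∧-true {marked y} q₂)) ,
                          inj₂ (trans (cong parent py≡c) (BadWitness.parent-child witness))

  W⊆⋃W-cover : ∀ w → W w ≡ true → w Subset.∈ ⋃ cuts-root W-cover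
  W⊆⋃W-cover w e with ∨-true {W₀ w} e
  ... | inj₂ adj-bad with adjacentTo⁻ Bad w adj-bad
  ... | x , bad , xw with Bad-near-marked x bad
  ... | q , q∈ , inj₁ pq≡x = ∈-⋃⁺ cuts-root W-cover q∈ (Subsetₚ.x∈p∪q⁺ (inj₂ (Subsetₚ.x∈p∪q⁺ (inj₂ (Subsetₚ.x∈p∪q⁺ (inj₁
      (subst (λ z → w Subset.∈ V₂-neighbours z) (sym pq≡x) (∈-V₂-neighbours x w (Bad⊆V₂ x bad) xw))))))))
  ... | q , q∈ , inj₂ ppq≡x = ∈-⋃⁺ cuts-root W-cover q∈ (Subsetₚ.x∈p∪q⁺ (inj₂ (Subsetₚ.x∈p∪q⁺ (inj₂ (Subsetₚ.x∈p∪q⁺ (inj₂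
      (subst (λ z → w Subset.∈ V₂-neighbours z) (sym ppq≡x) (∈-V₂-neighbours x w (Bad⊆V₂ x bad) xw))))))))
  W⊆⋃W-cover w e | inj₁ w₀ with ∨-true {Q₁ w} w₀
  ... | inj₁ q₁ = ∈-⋃⁺ cuts-root W-cover (marked⇒∈cuts-root w (proj₁ (∧-true {marked w} q₁))) (Subsetₚ.x∈p∪q⁺ (inj₁ (Subsetₚ.x∈⁅x⁆ w)))
  ... | inj₂ adj₂ with adjacentTo⁻ Q₂ w adj₂
  ... | x , q₂ , xw = ∈-⋃⁺ cuts-root W-cover (marked⇒∈cuts-root x (proj₁ (∧-true {marked x} q₂)))
      (Subsetₚ.x∈p∪q⁺ (inj₂ (Subsetₚ.x∈p∪q⁺ (inj₁ (∈-V₂-neighbours x w (proj₂ (∧-true {marked x} q₂)) xw)))))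

  ∣W∣≤ : ∣ Wset ∣ ≤ length cuts-root * (1 + (Δ + (Δ + Δ)))
  ∣W∣≤ = ≤-trans (Subsetₚ.p⊆q⇒∣p∣≤∣q∣ (λ {w} w∈ → W⊆⋃W-cover w (∈-tabulate⁻ W w w∈))) (∣⋃∣≤ cuts-root W-cover _ ∣W-cover∣≤)

  Pvertices-length : length Pvertices ≤ 3 * length cuts-root
  Pvertices-length = ≤-trans (Unique⇒length≤ Pvertices (concatMap candidates cuts-root) Pvertices-Unique ⊆candidates)
                             (≤-reflexive (length-candidates cuts-root))
    where
    candidates : Fin n → List (Fin n)
    candidates q = q ∷ parent q ∷ parent (parent q) ∷ []
    length-candidates : ∀ qs → length (concatMap candidates qs) ≡ 3 * length qs
    length-candidates [] = refl
    length-candidates (q ∷ qs) = trans (cong (3 +_) (length-candidates qs)) (sym (*-suc 3 (length qs)))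
    ⊆candidates : ∀ p → p ∈ Pvertices → p ∈ concatMap candidates cuts-root
    ⊆candidates p p∈ with ∨-true {Q₂ p} (∈-Pvertices⁻ p∈)
    ... | inj₁ q₂ = ∈-concatMap⁺′ candidates cuts-root (marked⇒∈cuts-root p (proj₁ (∧-true {marked p} q₂))) (here refl)
    ... | inj₂ bad with Bad-near-marked p bad
    ... | q , q∈ , inj₁ e = ∈-concatMap⁺′ candidates cuts-root q∈ (there (here (sym e)))
    ... | q , q∈ , inj₂ e = ∈-concatMap⁺′ candidates cuts-root q∈ (there (there (here (sym e))))

  boundary : ∀ K → K ∈ 𝒟′ ++ 𝒟″ → ∀ u v → u Subset.∈ K → E T u v → ¬ (v Subset.∈ K) → v Subset.∈ Wset
  boundary K K∈ u v u∈ uv v∉ with ∈-𝒟⁻ K K∈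
  ... | inj₂ (p , p∈ , refl) =
    ∈-tabulate⁺ W v (P-neighbour∈W p v (∈-Pvertices⁻ p∈) (subst (λ z → E T z v) (Subsetₚ.x∈⁅y⁆⇒x≡y p u∈) uv))
  ... | inj₁ (t , t∈ , refl) with ∈-block⁻ t u u∈
  ... | ∉Su , top≡ = ∈-tabulate⁺ W v (by-cases (S v) refl)
    where
    by-cases : ∀ b → S v ≡ b → W v ≡ true
    by-cases false ∉Sv with edge-parent uv
    ... | inj₁ (v≢root , pv≡u) = ⊥-elim (v∉ (∈-block⁺ t v ∉Sv
          (trans (top-parent S v v≢root (subst (λ z → S z ≡ false) (sym pv≡u) ∉Su)) (trans (cong (top S) pv≡u) top≡))))
    ... | inj₂ (u≢root , pu≡v) = ⊥-elim (v∉ (∈-block⁺ t v ∉Sv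
          (trans (sym (trans (top-parent S u u≢root (subst (λ z → S z ≡ false) (sym pu≡v) ∉Sv)) (cong (top S) pu≡v))) top≡)))
    by-cases true ∈S with ∨-true {W v} ∈S
    ... | inj₁ ∈W = ∈W
    ... | inj₂ ∈P = ⊥-elim (true≢false (W⊆S u (P-neighbour∈W v u ∈P (E-sym T uv))) ∉Su)

  singleton-neighbours : ∀ p → P p ≡ true → ∣ Wset ∩ Nbhd T ⁅ p ⁆ ∣ ≤ Δ
  singleton-neighbours p p∈ = ≤-trans (Subsetₚ.p⊆q⇒∣p∣≤∣q∣ ⊆adj) (deg≤Δ p (P⊆V₂ p p∈))
    where
    ⊆adj : ∀ {w} → w Subset.∈ Wset ∩ Nbhd T ⁅ p ⁆ → w Subset.∈ tabulate (adj p)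
    ⊆adj {w} w∈ with ∈-Nbhd⁻ ⁅ p ⁆ w (proj₂ (Subsetₚ.x∈p∩q⁻ Wset _ w∈))
    ... | u , u∈ , uw = ∈-tabulate⁺ (adj p) w (subst (λ z → E T z w) (Subsetₚ.x∈⁅y⁆⇒x≡y p u∈) uw)

  oneSidedFine : 1 ≤ ℓ → 1 ≤ k → OneSidedFine T k χ ℓ Wset 𝒟′ 𝒟″
  oneSidedFine 1≤ℓ 1≤k = record
    { subtrees  = subtrees
    ; W⊆V₁      = λ v v∈ → W⊆V₁ v (∈-tabulate⁻ W v v∈)
    ; partition = partition
    ; sizeW     = W-size-bound k Δ (length cuts-root) ∣ Wset ∣ ℓ 1≤k ∣W∣≤ marked-count
    ; smallK    = small
    ; boundary  = boundary
    ; D₁-few    = few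
    ; D₁-far    = far
    ; D₂-count  = subst (λ m → m * ℓ ≤ 336 * k) (sym (length-map ⁅_⁆ Pvertices))
                    (P-size-bound k (length cuts-root) (length Pvertices) ℓ 1≤k Pvertices-length marked-count)
    ; D₂-single = single
    ; D₂-nbrs   = nbrs
    }
    where
    subtrees : ∀ K → K ∈ 𝒟′ ++ 𝒟″ → IsSubtree T K
    subtrees K K∈ with ∈-𝒟⁻ K K∈
    ... | inj₁ (t , t∈ , refl) = block-subtree t (∈-blockTops⁻ t∈)
    ... | inj₂ (p , _ , refl) = ⁅⁆-subtree p
    small : ∀ K → K ∈ 𝒟′ ++ 𝒟″ → ∣ K ∣ ≤ ℓ
    small K K∈ with ∈-𝒟⁻ K K∈
    ... | inj₁ (t , t∈ , refl) = <⇒≤ (block-small t (∈-blockTops⁻ t∈))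
    ... | inj₂ (p , _ , refl) = subst (_≤ ℓ) (sym (Subsetₚ.∣⁅x⁆∣≡1 p)) 1≤ℓ
    few : ∀ K → K ∈ 𝒟′ → ∣ Wset ∩ Nbhd T K ∣ ≤ 2
    few K K∈ with ∈-map⁻ block K∈
    ... | t , _ , refl = block-few-neighbours t
    far : ∀ K → K ∈ 𝒟′ → ∀ z₁ z₂ → z₁ Subset.∈ Wset ∩ Nbhd T K → z₂ Subset.∈ Wset ∩ Nbhd T K →
          z₁ ≢ z₂ → DistAtLeast T 4 z₁ z₂
    far K K∈ with ∈-map⁻ block K∈
    ... | t , t∈ , refl = block-neighbours-far t (∈-blockTops⁻ t∈)
    single : ∀ K → K ∈ 𝒟″ → ∣ K ∣ ≡ 1
    single K K∈ with ∈-map⁻ ⁅_⁆ K∈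
    ... | p , _ , refl = Subsetₚ.∣⁅x⁆∣≡1 p
    nbrs : ∀ K → K ∈ 𝒟″ → ∣ Wset ∩ Nbhd T K ∣ ≤ Δ
    nbrs K K∈ with ∈-map⁻ ⁅_⁆ K∈
    ... | p , p∈ , refl = singleton-neighbours p (∈-Pvertices⁻ p∈)

lemma3p5 : (k : ℕ) (T : Graph (suc k)) → IsTree T →
    (χ : Fin (suc k) → Bool) → ProperColouring T χ →
    (ℓ : ℕ) → 1 ≤ ℓ → ℓ < k →
    Σ (Subset (suc k)) λ W → Σ (List (Subset (suc k))) λ D₁ → Σ (List (Subset (suc k))) λ D₂ →
    OneSidedFine T k χ ℓ W D₁ D₂
lemma3p5 k T tree χ proper ℓ 1≤ℓ ℓ<k = Wset , 𝒟′ , 𝒟″ , oneSidedFine 1≤ℓ (≤-trans 1≤ℓ (<⇒≤ ℓ<k))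
  where open Partition k T tree χ proper ℓ
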